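{- Let $q=p^{r}$ with $p$ prime, let $n\ge 2$, and let $f(x)=x^{n}+\sum_{i=1}^{n}(-1)^{i}f_{i}x^{n-i}\in\mathbb{F}_{q}[x]$ be irreducible of degree $n$ over $\mathbb{F}_{q}$ with a root $\alpha\in\mathbb{F}_{q^{n}}$. Let $k$ be a positive integer with $k<n$ and $p\nmid k$. Then $$f_{k}=\frac{1}{k}\,\mathrm{Tr}\big(\alpha\,W_{k,n}(\alpha)\big).$$
   Context: $\mathrm{Tr}$ denotes the trace map from $\mathbb{F}_{q^{n}}$ to $\mathbb{F}_{q}$. For positive integers $k<n$, $W_{k,n}(x)$ is the polynomial $$W_{k,n}(x)=\sum_{1\le i_{1}<i_{2}<\cdots<i_{k-1}\le n-1} x^{q^{i_{1}}+q^{i_{2}}+\cdots+q^{i_{k-1}}},$$ i.e. the sum of $x^{\sum_{s\in S}q^{s}}$ over all $(k-1)$-element subsets $S\subseteq\{1,\dots,n-1\}$; it has $\binom{n-1}{k-1}$ terms, and $W_{1,n}(x)=1$, $W_{2,n}(x)=x^{q}+x^{q^{2}}+\cdots+x^{q^{n-1}}$. The fraction $\frac1k$ is the inverse of $k$ in $\mathbb{F}_q$. -}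

module Defs where

open import Level using (Level; _⊔_)
open import Data.Nat as ℕ using (ℕ; zero; suc; _∸_; _<ᵇ_; _≡ᵇ_)
open import Data.Bool using (if_then_else_)
open import Data.Fin using (Fin; toℕ)
open import Data.List using (List; []; _∷_; map; _++_; upTo; foldr)
open import Data.Product using (Σ; _×_; _,_)
open import Relation.Nullary using (¬_)
open import Relation.Binary.PropositionalEquality using (_≡_)
open import Algebra.Bundles using (CommutativeRing)
open import Algebra.Morphism.Structures using (module RingMorphisms)

record IsField {c ℓ} (R : CommutativeRing c ℓ) : Set (c ⊔ ℓ) where
  open CommutativeRing R
  field
    0≉1 : ¬ (0# ≈ 1#)
    inverse : ∀ x → ¬ (x ≈ 0#) → Σ Carrier (λ y → (x * y) ≈ 1#)

record HasCard {c ℓ} (R : CommutativeRing c ℓ) (N : ℕ) : Set (c ⊔ ℓ) where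
  open CommutativeRing R
  field
    to      : Carrier → Fin N
    from    : Fin N → Carrier
    to-cong : ∀ {x y} → x ≈ y → to x ≡ to y
    from-to : ∀ x → from (to x) ≈ x
    to-from : ∀ i → to (from i) ≡ i

IsRingHom : ∀ {c ℓ c' ℓ'} (K : CommutativeRing c ℓ) (L : CommutativeRing c' ℓ') →
            (CommutativeRing.Carrier K → CommutativeRing.Carrier L) → Set (c ⊔ ℓ ⊔ ℓ')
IsRingHom K L ι = RingMorphisms.IsRingHomomorphism (CommutativeRing.rawRing K) (CommutativeRing.rawRing L) ι

-- (j)-element sublists (= j-element subsets, in increasing order) of a list
choose : ∀ {a} {A : Set a} → ℕ → List A → List (List A)
choose zero    xs       = [] ∷ []
choose (suc j) []       = []
choose (suc j) (x ∷ xs) = map (x ∷_) (choose j xs) ++ choose (suc j) xs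

module _ {c ℓ} (R : CommutativeRing c ℓ) where
  open CommutativeRing R

  pow : Carrier → ℕ → Carrier
  pow x zero    = 1#
  pow x (suc m) = x * pow x m

  sumR : ℕ → (ℕ → Carrier) → Carrier
  sumR zero    f = 0#
  sumR (suc m) f = sumR m f + f m

  sumList : List Carrier → Carrier
  sumList = foldr _+_ 0#

  fromℕ : ℕ → Carrier
  fromℕ zero    = 0#
  fromℕ (suc m) = 1# + fromℕ m

  monicCoeff : ℕ → (ℕ → Carrier) → ℕ → Carrier
  monicCoeff d a m = if m <ᵇ d then a m else (if m ≡ᵇ d then 1# else 0#)

  mulCoeff : (ℕ → Carrier) → (ℕ → Carrier) → ℕ → Carrier
  mulCoeff a b m = sumR (suc m) (λ i → a i * b (m ∸ i))

  IrreducibleMonic : ℕ → (ℕ → Carrier) → Set (c ⊔ ℓ)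
  IrreducibleMonic n a =
    ∀ d e → 1 ℕ.≤ d → 1 ℕ.≤ e → d ℕ.+ e ≡ n → (g h : ℕ → Carrier) →
    ¬ (∀ m → mulCoeff (monicCoeff d g) (monicCoeff e h) m ≈ monicCoeff n a m)

  -- Lower coefficients of f(x) = x^n + Σ_{i=1}^n (-1)^i f_i x^(n-i):
  -- coefficient of x^m (m < n) is (-1)^(n-m) f_(n-m).
  fLower : ℕ → (ℕ → Carrier) → ℕ → Carrier
  fLower n fc m = pow (- 1#) (n ∸ m) * fc (n ∸ m)

  Tr : ℕ → ℕ → Carrier → Carrier
  Tr q n y = sumR n (λ i → pow y (q ℕ.^ i))

  -- W_{k,n}(x) = Σ over (k-1)-subsets S of {1,…,n-1} of x^(Σ_{s∈S} q^s)
  W : ℕ → ℕ → ℕ → Carrier → Carrier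
  W q k n x = sumList (map (λ S → pow x (foldr (λ s t → q ℕ.^ s ℕ.+ t) 0 S))
                           (choose (k ∸ 1) (map suc (upTo (n ∸ 1)))))

-- The conjugates βᵢ = α ^ qⁱ (i < n) are roots of f, since x ↦ xᵠ fixes K, and they are
-- pairwise distinct: for a least d < n with β_d = β₀, the factor ∏_{i<d} (X - βᵢ) of f and its
-- cofactor are invariant under x ↦ xᵠ, hence defined over K, contradicting irreducibility.
-- So f = ∏_{i<n} (X - βᵢ) and f_k = e_k(β₀, …, β_{n-1}) by Vieta. Moreover, the i-th conjugate of
-- α W_{k,n}(α) is βᵢ e_{k-1}(the other βⱼ); summing over i counts each k-subset k times, so
-- Tr(α W_{k,n}(α)) = k e_k(β) = k f_k.
module Submission where

open import Defs
open import Level using (_⊔_)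
open import Data.Bool using (true; false; T)
open import Data.Unit using (tt)
open import Data.Empty using (⊥-elim)
open import Data.Nat as ℕ using (ℕ; zero; suc; _∸_; _!; z≤n; s≤s; _≤_; _<_)
import Data.Nat.Properties as ℕP
open import Data.Nat.Divisibility using (_∣_; divides; ∣⇒≤; m∣m*n)
open import Data.Nat.DivMod using (m/n*n≡m)
open import Data.Nat.Primality using (Prime; ¬prime[0]; ¬prime[1]; euclidsLemma; prime⇒nonZero; prime⇒nonTrivial)
open import Data.Nat.Combinatorics using (_C_; k![n∸k]!∣n!; nCk≡nC[n∸k]; nCn≡1)
open import Data.Nat.Combinatorics.Specification using (nCk≡n!/k![n-k]!)
open import Data.Fin as Fin using (Fin; toℕ; inject₁)
import Data.Fin.Properties as FinP
open import Data.Fin.Permutation using (Permutation; permutation)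
open import Data.Vec.Functional using (removeAt)
open import Data.List using (List; []; _∷_; _++_; map; length; applyUpTo; upTo; foldr; tabulate)
import Data.List.Properties as ListP
open import Data.List.Relation.Unary.All as All using (All; []; _∷_)
import Data.List.Relation.Unary.All.Properties as AllP
open import Data.List.Relation.Unary.AllPairs using ([]; _∷_)
import Data.List.Relation.Unary.Unique.Setoid as UniqueS
import Data.List.Relation.Unary.Unique.Setoid.Properties as UniqueP
open import Data.Product using (Σ; _×_; _,_; proj₁; proj₂)
open import Data.Sum using (_⊎_; inj₁; inj₂)
open import Function using (_∘_)
open import Relation.Nullary using (¬_; Dec; yes; no)
open import Relation.Binary.Definitions using (tri<; tri≈; tri>)
open import Relation.Binary.PropositionalEquality as ≡ using (_≡_; _≢_)
open import Algebra.Bundles using (CommutativeRing)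
open import Algebra.Morphism.Structures using (module RingMorphisms)
import Algebra.Properties.CommutativeMonoid.Sum as Sum
import Algebra.Properties.CommutativeSemiring.Binomial as Binomial

prime⇒2≤p : ∀ {p} → Prime p → 2 ≤ p
prime⇒2≤p {p} pr = ℕ.nonTrivial⇒n>1 p {{prime⇒nonTrivial pr}}

prime∤m! : ∀ {p} → Prime p → ∀ m → m < p → ¬ p ∣ m !
prime∤m! pr zero    m<p p∣1 = ℕP.<⇒≱ (prime⇒2≤p pr) (∣⇒≤ p∣1)
prime∤m! pr (suc m) m<p p∣m! with euclidsLemma (suc m) (m !) pr p∣m!
... | inj₁ p∣1+m = ℕP.<⇒≱ m<p (∣⇒≤ p∣1+m)
... | inj₂ p∣m!  = prime∤m! pr m (ℕP.<-trans (ℕP.n<1+n m) m<p) p∣m!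

prime∣pCk : ∀ {p k} → Prime p → 0 < k → k < p → p ∣ p C k
prime∣pCk {p} {k} pr 0<k k<p with euclidsLemma (p C k) (k ! ℕ.* (p ∸ k) !) pr p∣pCk*k!*[p-k]!
  where
  instance _ = ℕP._!*_!≢0 k (p ∸ k)
  k≤p = ℕP.<⇒≤ k<p
  p∣p! : ∀ p → 0 < p → p ∣ p !
  p∣p! (suc p) _ = m∣m*n (p !)
  p∣pCk*k!*[p-k]! : p ∣ (p C k) ℕ.* (k ! ℕ.* (p ∸ k) !)
  p∣pCk*k!*[p-k]! = ≡.subst (p ∣_)
    (≡.sym (≡.trans (≡.cong (ℕ._* (k ! ℕ.* (p ∸ k) !)) (nCk≡n!/k![n-k]! k≤p)) (m/n*n≡m (k![n∸k]!∣n! k≤p))))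
    (p∣p! p (ℕP.<-trans 0<k k<p))
... | inj₁ p∣pCk = p∣pCk
... | inj₂ p∣k!*[p-k]! with euclidsLemma (k !) ((p ∸ k) !) pr p∣k!*[p-k]!
...   | inj₁ p∣k!     = ⊥-elim (prime∤m! pr k k<p p∣k!)
...   | inj₂ p∣[p-k]! = ⊥-elim (prime∤m! pr (p ∸ k) (ℕP.∸-monoʳ-< {p} {k} {0} 0<k (ℕP.<⇒≤ k<p)) p∣[p-k]!)

module RingArithmetic {c ℓ} (R : CommutativeRing c ℓ) where
  open CommutativeRing R hiding (zero)
  open import Relation.Binary.Reasoning.Setoid setoid public
  open import Algebra.Solver.Ring.NaturalCoefficients.Default commutativeSemiring public
  open import Algebra.Properties.Ring ring public
    using ( -‿distribˡ-*; -‿involutive; -‿+-comm; -0#≈0#; -1*x≈-x; +-cancelʳ; +-inverseˡ-unique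
          ; x≈z//y; x∙y⁻¹≈ε⇒x≈y; x≈y⇒x∙y⁻¹≈ε; x[y-z]≈xy-xz)
  open import Algebra.Properties.CommutativeSemigroup *-commutativeSemigroup public using (x∙yz≈y∙xz)

  infixr 8 _^_
  _^_ : Carrier → ℕ → Carrier
  _^_ = pow R

  ∑ : ℕ → (ℕ → Carrier) → Carrier
  ∑ = sumR R

  ^-congˡ : ∀ {x y} m → x ≈ y → x ^ m ≈ y ^ m
  ^-congˡ zero    e = refl
  ^-congˡ (suc m) e = *-cong e (^-congˡ m e)

  ^-homo-* : ∀ x m n → x ^ (m ℕ.+ n) ≈ x ^ m * x ^ n
  ^-homo-* x zero    n = sym (*-identityˡ _)
  ^-homo-* x (suc m) n = trans (*-congˡ (^-homo-* x m n)) (sym (*-assoc x _ _))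

  ^-distrib-* : ∀ x y n → (x * y) ^ n ≈ x ^ n * y ^ n
  ^-distrib-* x y zero    = sym (*-identityˡ 1#)
  ^-distrib-* x y (suc n) = trans (*-congˡ (^-distrib-* x y n))
    (solve 4 (λ x y a b → (x :* y) :* (a :* b) := (x :* a) :* (y :* b)) refl x y (x ^ n) (y ^ n))

  1^n≈1 : ∀ n → 1# ^ n ≈ 1#
  1^n≈1 zero    = refl
  1^n≈1 (suc n) = trans (*-identityˡ _) (1^n≈1 n)

  ^-assocʳ : ∀ x m n → x ^ (m ℕ.* n) ≈ (x ^ m) ^ n
  ^-assocʳ x zero    n = sym (1^n≈1 n)
  ^-assocʳ x (suc m) n = begin
    x ^ (n ℕ.+ m ℕ.* n)       ≈⟨ ^-homo-* x n (m ℕ.* n) ⟩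
    x ^ n * x ^ (m ℕ.* n)     ≈⟨ *-congˡ (^-assocʳ x m n) ⟩
    x ^ n * (x ^ m) ^ n       ≈⟨ ^-distrib-* x (x ^ m) n ⟨
    (x * x ^ m) ^ n           ∎

  [-1]^n*[-1]^n≈1 : ∀ n → (- 1#) ^ n * (- 1#) ^ n ≈ 1#
  [-1]^n*[-1]^n≈1 n = begin
    (- 1#) ^ n * (- 1#) ^ n   ≈⟨ ^-distrib-* (- 1#) (- 1#) n ⟨
    (- 1# * - 1#) ^ n         ≈⟨ ^-congˡ n (trans (-1*x≈-x (- 1#)) (-‿involutive 1#)) ⟩
    1# ^ n                    ≈⟨ 1^n≈1 n ⟩
    1#                        ∎

  ∑-cong : ∀ N {f g : ℕ → Carrier} → (∀ i → i < N → f i ≈ g i) → ∑ N f ≈ ∑ N g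
  ∑-cong zero    e = refl
  ∑-cong (suc N) e = +-cong (∑-cong N (λ i i<N → e i (ℕP.m<n⇒m<1+n i<N))) (e N ℕP.≤-refl)

  ∑-cons : ∀ N (f : ℕ → Carrier) → ∑ (suc N) f ≈ f 0 + ∑ N (f ∘ suc)
  ∑-cons zero    f = trans (+-identityˡ _) (sym (+-identityʳ _))
  ∑-cons (suc N) f = trans (+-congʳ (∑-cons N f)) (+-assoc _ _ _)

  ∑-distrib-+ : ∀ N (f g : ℕ → Carrier) → ∑ N (λ i → f i + g i) ≈ ∑ N f + ∑ N g
  ∑-distrib-+ zero    f g = sym (+-identityˡ 0#)
  ∑-distrib-+ (suc N) f g = trans (+-congʳ (∑-distrib-+ N f g))
    (solve 4 (λ a b c d → (a :+ b) :+ (c :+ d) := (a :+ c) :+ (b :+ d)) refl (∑ N f) (∑ N g) (f N) (g N))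

  *-distribˡ-∑ : ∀ N x (f : ℕ → Carrier) → x * ∑ N f ≈ ∑ N (λ i → x * f i)
  *-distribˡ-∑ zero    x f = zeroʳ x
  *-distribˡ-∑ (suc N) x f = trans (distribˡ x _ _) (+-congʳ (*-distribˡ-∑ N x f))

  ∑-zero : ∀ N (f : ℕ → Carrier) → (∀ i → i < N → f i ≈ 0#) → ∑ N f ≈ 0#
  ∑-zero zero    f e = refl
  ∑-zero (suc N) f e = trans (+-cong (∑-zero N f (λ i i<N → e i (ℕP.m<n⇒m<1+n i<N))) (e N ℕP.≤-refl))
                             (+-identityʳ 0#)

  fromℕ-+ : ∀ m n → fromℕ R (m ℕ.+ n) ≈ fromℕ R m + fromℕ R n
  fromℕ-+ zero    n = sym (+-identityˡ _)
  fromℕ-+ (suc m) n = trans (+-congˡ (fromℕ-+ m n)) (sym (+-assoc _ _ _))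

  fromℕ-* : ∀ m n → fromℕ R (m ℕ.* n) ≈ fromℕ R m * fromℕ R n
  fromℕ-* zero    n = sym (zeroˡ _)
  fromℕ-* (suc m) n = begin
    fromℕ R (n ℕ.+ m ℕ.* n)                  ≈⟨ fromℕ-+ n (m ℕ.* n) ⟩
    fromℕ R n + fromℕ R (m ℕ.* n)            ≈⟨ +-congˡ (fromℕ-* m n) ⟩
    fromℕ R n + fromℕ R m * fromℕ R n        ≈⟨ solve 2 (λ a b → a :+ b :* a := (con 1 :+ b) :* a) refl (fromℕ R n) (fromℕ R m) ⟩
    (1# + fromℕ R m) * fromℕ R n             ∎

  fromℕ-^ : ∀ m s → fromℕ R (m ℕ.^ s) ≈ fromℕ R m ^ s
  fromℕ-^ m zero    = +-identityʳ 1#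
  fromℕ-^ m (suc s) = trans (fromℕ-* m (m ℕ.^ s)) (*-congˡ (fromℕ-^ m s))

  sumList-++ : ∀ xs ys → sumList R (xs ++ ys) ≈ sumList R xs + sumList R ys
  sumList-++ []       ys = sym (+-identityˡ _)
  sumList-++ (x ∷ xs) ys = trans (+-congˡ (sumList-++ xs ys)) (sym (+-assoc _ _ _))

  sumList-map-* : ∀ {A : Set} x (g h : A → Carrier) zs → (∀ z → h z ≈ x * g z) →
    sumList R (map h zs) ≈ x * sumList R (map g zs)
  sumList-map-* x g h []       _      = sym (zeroʳ x)
  sumList-map-* x g h (z ∷ zs) h≈x*g = trans (+-cong (h≈x*g z) (sumList-map-* x g h zs h≈x*g)) (sym (distribˡ _ _ _))

module ElementarySymmetric {c ℓ} (R : CommutativeRing c ℓ) where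
  open CommutativeRing R hiding (zero)
  open RingArithmetic R
  open import Data.List.Relation.Binary.Equality.Setoid setoid public using (_≋_; []; _∷_; ≋-refl; ≋-reflexive; ≋-trans; ++⁺)

  applyUpTo-cong : ∀ m {g h : ℕ → Carrier} → (∀ s → s < m → g s ≈ h s) → applyUpTo g m ≋ applyUpTo h m
  applyUpTo-cong zero    g≈h = []
  applyUpTo-cong (suc m) g≈h = g≈h 0 (s≤s z≤n) ∷ applyUpTo-cong m (λ s s<m → g≈h (suc s) (s≤s s<m))

  esym : ℕ → List Carrier → Carrier
  esym zero    xs       = 1#
  esym (suc j) []       = 0#
  esym (suc j) (x ∷ xs) = x * esym j xs + esym (suc j) xs

  esym-cong : ∀ {xs ys} → xs ≋ ys → ∀ j → esym j xs ≈ esym j ys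
  esym-cong p         zero    = refl
  esym-cong []        (suc j) = refl
  esym-cong (x≈y ∷ p) (suc j) = +-cong (*-cong x≈y (esym-cong p j)) (esym-cong p (suc j))

  esym-∷-cong : ∀ {xs ys} x → (∀ j → esym j xs ≈ esym j ys) → ∀ j → esym j (x ∷ xs) ≈ esym j (x ∷ ys)
  esym-∷-cong x e zero    = refl
  esym-∷-cong x e (suc j) = +-cong (*-congˡ (e j)) (e (suc j))

  esym-swap : ∀ x y xs j → esym j (x ∷ y ∷ xs) ≈ esym j (y ∷ x ∷ xs)
  esym-swap x y xs zero          = refl
  esym-swap x y xs (suc zero)    =
    solve 3 (λ x y e → x :* con 1 :+ (y :* con 1 :+ e) := y :* con 1 :+ (x :* con 1 :+ e)) refl x y (esym 1 xs)
  esym-swap x y xs (suc (suc j)) =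
    solve 5 (λ x y e₀ e₁ e₂ → x :* (y :* e₀ :+ e₁) :+ (y :* e₁ :+ e₂) := y :* (x :* e₀ :+ e₁) :+ (x :* e₁ :+ e₂))
      refl x y (esym j xs) (esym (suc j) xs) (esym (suc (suc j)) xs)

  esym-++-comm : ∀ xs ys j → esym j (xs ++ ys) ≈ esym j (ys ++ xs)
  esym-++-comm []       ys j = esym-cong (≋-reflexive (≡.sym (ListP.++-identityʳ ys))) j
  esym-++-comm (x ∷ xs) ys j = trans (esym-∷-cong x (esym-++-comm xs ys) j) (sym (move-to-front ys j))
    where
    move-to-front : ∀ zs j → esym j (zs ++ x ∷ xs) ≈ esym j (x ∷ zs ++ xs)
    move-to-front []       j = refl
    move-to-front (z ∷ zs) j = trans (esym-∷-cong z (move-to-front zs) j) (esym-swap z x (zs ++ xs) j)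

  esym-vanishes : ∀ xs j → length xs < j → esym j xs ≈ 0#
  esym-vanishes []       (suc j) _         = refl
  esym-vanishes (x ∷ xs) (suc j) (s≤s lt) = begin
    x * esym j xs + esym (suc j) xs   ≈⟨ +-cong (*-congˡ (esym-vanishes xs j lt)) (esym-vanishes xs (suc j) (ℕP.m<n⇒m<1+n lt)) ⟩
    x * 0# + 0#                       ≈⟨ trans (+-identityʳ _) (zeroʳ x) ⟩
    0#                                ∎

  esym-map-neg : ∀ xs j → esym j (map -_ xs) ≈ (- 1#) ^ j * esym j xs
  esym-map-neg xs       zero    = sym (*-identityˡ 1#)
  esym-map-neg []       (suc j) = sym (zeroʳ _)
  esym-map-neg (x ∷ xs) (suc j) = begin
    - x * esym j (map -_ xs) + esym (suc j) (map -_ xs)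
      ≈⟨ +-cong (*-cong (sym (-1*x≈-x x)) (esym-map-neg xs j)) (esym-map-neg xs (suc j)) ⟩
    (- 1# * x) * ((- 1#) ^ j * esym j xs) + (- 1# * (- 1#) ^ j) * esym (suc j) xs
      ≈⟨ solve 5 (λ m x p e₁ e₂ → (m :* x) :* (p :* e₁) :+ (m :* p) :* e₂ := (m :* p) :* (x :* e₁ :+ e₂))
           refl (- 1#) x ((- 1#) ^ j) (esym j xs) (esym (suc j) xs) ⟩
    (- 1# * (- 1#) ^ j) * (x * esym j xs + esym (suc j) xs) ∎

  nth : List Carrier → ℕ → Carrier
  nth []       _       = 0#
  nth (x ∷ xs) zero    = x
  nth (x ∷ xs) (suc i) = nth xs i

  deleteNth : List Carrier → ℕ → List Carrier
  deleteNth []       _       = []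
  deleteNth (x ∷ xs) zero    = xs
  deleteNth (x ∷ xs) (suc i) = x ∷ deleteNth xs i

  nth-applyUpTo : ∀ (h : ℕ → Carrier) {N i} → i < N → nth (applyUpTo h N) i ≡ h i
  nth-applyUpTo h {suc N} {zero}  _         = ≡.refl
  nth-applyUpTo h {suc N} {suc i} (s≤s i<N) = nth-applyUpTo (h ∘ suc) i<N

  applyUpTo-+ : ∀ (h : ℕ → Carrier) a b → applyUpTo h (a ℕ.+ b) ≡ applyUpTo h a ++ applyUpTo (λ s → h (a ℕ.+ s)) b
  applyUpTo-+ h zero    b = ≡.refl
  applyUpTo-+ h (suc a) b = ≡.cong (h 0 ∷_) (applyUpTo-+ (h ∘ suc) a b)

  deleteNth-applyUpTo : ∀ (h : ℕ → Carrier) {N i} → i < N →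
    deleteNth (applyUpTo h N) i ≡ applyUpTo h i ++ applyUpTo (λ s → h (suc i ℕ.+ s)) (N ∸ suc i)
  deleteNth-applyUpTo h {suc N} {zero}  _         = ≡.refl
  deleteNth-applyUpTo h {suc N} {suc i} (s≤s i<N) = ≡.cong (h 0 ∷_) (deleteNth-applyUpTo (h ∘ suc) i<N)

  -- Each (j+1)-subset of xs arises j+1 times as {xᵢ} ∪ (a j-subset of xs without xᵢ).
  ∑-nth*esym-deleteNth : ∀ xs j →
    ∑ (length xs) (λ i → nth xs i * esym j (deleteNth xs i)) ≈ fromℕ R (suc j) * esym (suc j) xs
  ∑-nth*esym-deleteNth []       j       = sym (zeroʳ _)
  ∑-nth*esym-deleteNth (x ∷ xs) zero    = begin
    ∑ (suc (length xs)) (λ i → nth (x ∷ xs) i * 1#)   ≈⟨ ∑-cons (length xs) _ ⟩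
    x * 1# + ∑ (length xs) (λ i → nth xs i * 1#)      ≈⟨ +-congˡ (∑-nth*esym-deleteNth xs zero) ⟩
    x * 1# + (1# + 0#) * esym 1 xs
      ≈⟨ solve 2 (λ x e → x :* con 1 :+ (con 1 :+ con 0) :* e := (con 1 :+ con 0) :* (x :* con 1 :+ e)) refl x (esym 1 xs) ⟩
    (1# + 0#) * (x * 1# + esym 1 xs)                   ∎
  ∑-nth*esym-deleteNth (x ∷ xs) (suc j) = begin
    ∑ (suc N) (λ i → nth (x ∷ xs) i * esym (suc j) (deleteNth (x ∷ xs) i))   ≈⟨ ∑-cons N _ ⟩
    x * esym (suc j) xs + ∑ N (λ i → nth xs i * (x * esym j (deleteNth xs i) + esym (suc j) (deleteNth xs i)))
      ≈⟨ +-congˡ (∑-cong N (λ i _ → split (nth xs i) (esym j (deleteNth xs i)) (esym (suc j) (deleteNth xs i)))) ⟩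
    x * esym (suc j) xs + ∑ N (λ i → x * (nth xs i * esym j (deleteNth xs i)) + nth xs i * esym (suc j) (deleteNth xs i))
      ≈⟨ +-congˡ (∑-distrib-+ N _ _) ⟩
    x * esym (suc j) xs + (∑ N (λ i → x * (nth xs i * esym j (deleteNth xs i)))
                            + ∑ N (λ i → nth xs i * esym (suc j) (deleteNth xs i)))
      ≈⟨ +-congˡ (+-cong (sym (*-distribˡ-∑ N x _)) (∑-nth*esym-deleteNth xs (suc j))) ⟩
    x * esym (suc j) xs + (x * ∑ N (λ i → nth xs i * esym j (deleteNth xs i)) + fromℕ R (2 ℕ.+ j) * esym (2 ℕ.+ j) xs)
      ≈⟨ +-congˡ (+-congʳ (*-congˡ (∑-nth*esym-deleteNth xs j))) ⟩
    x * esym (suc j) xs + (x * (fromℕ R (suc j) * esym (suc j) xs) + fromℕ R (2 ℕ.+ j) * esym (2 ℕ.+ j) xs)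
      ≈⟨ solve 4 (λ x a e₁ e₂ → x :* e₁ :+ (x :* (a :* e₁) :+ (con 1 :+ a) :* e₂) := (con 1 :+ a) :* (x :* e₁ :+ e₂))
           refl x (fromℕ R (suc j)) (esym (suc j) xs) (esym (2 ℕ.+ j) xs) ⟩
    fromℕ R (2 ℕ.+ j) * esym (2 ℕ.+ j) (x ∷ xs)   ∎
    where
    N = length xs
    split : ∀ a b c → a * (x * b + c) ≈ x * (a * b) + a * c
    split = solve 4 (λ x a b c → a :* (x :* b :+ c) := x :* (a :* b) :+ a :* c) refl x

  -- The monomial of a subset S is y ^ ∑_{s ∈ S} qˢ = ∏_{s ∈ S} y ^ qˢ.
  sum-choose≈esym : ∀ q y j ss →
    sumList R (map (λ S → y ^ foldr (λ s t → q ℕ.^ s ℕ.+ t) 0 S) (choose j ss)) ≈ esym j (map (λ s → y ^ (q ℕ.^ s)) ss)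
  sum-choose≈esym q y zero    ss       = +-identityʳ 1#
  sum-choose≈esym q y (suc j) []       = refl
  sum-choose≈esym q y (suc j) (s ∷ ss) = begin
    sumList R (map monomial (map (s ∷_) (choose j ss) ++ choose (suc j) ss))
      ≈⟨ reflexive (≡.cong (sumList R) (ListP.map-++ monomial (map (s ∷_) (choose j ss)) (choose (suc j) ss))) ⟩
    sumList R (map monomial (map (s ∷_) (choose j ss)) ++ map monomial (choose (suc j) ss))
      ≈⟨ sumList-++ (map monomial (map (s ∷_) (choose j ss))) (map monomial (choose (suc j) ss)) ⟩
    sumList R (map monomial (map (s ∷_) (choose j ss))) + sumList R (map monomial (choose (suc j) ss))
      ≈⟨ +-cong (trans (reflexive (≡.cong (sumList R) (≡.sym (ListP.map-∘ (choose j ss)))))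
                       (sumList-map-* (y ^ (q ℕ.^ s)) monomial (monomial ∘ (s ∷_)) (choose j ss) (λ S → ^-homo-* y (q ℕ.^ s) _)))
                (sum-choose≈esym q y (suc j) ss) ⟩
    y ^ (q ℕ.^ s) * sumList R (map monomial (choose j ss)) + esym (suc j) (map (λ s → y ^ (q ℕ.^ s)) ss)
      ≈⟨ +-congʳ (*-congˡ (sum-choose≈esym q y j ss)) ⟩
    y ^ (q ℕ.^ s) * esym j (map (λ s → y ^ (q ℕ.^ s)) ss) + esym (suc j) (map (λ s → y ^ (q ℕ.^ s)) ss) ∎
    where
    monomial : List ℕ → Carrier
    monomial S = y ^ foldr (λ s t → q ℕ.^ s ℕ.+ t) 0 S


module FieldProperties {c ℓ} (R : CommutativeRing c ℓ) (F : IsField R) where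
  open CommutativeRing R hiding (zero)
  open RingArithmetic R
  open IsField F

  x≉0∧x*y≈0⇒y≈0 : ∀ {x y} → ¬ x ≈ 0# → x * y ≈ 0# → y ≈ 0#
  x≉0∧x*y≈0⇒y≈0 {x} {y} x≉0 xy≈0 with inverse x x≉0
  ... | x⁻¹ , xx⁻¹≈1 = begin
    y               ≈⟨ *-identityˡ y ⟨
    1# * y          ≈⟨ *-congʳ (trans (sym xx⁻¹≈1) (*-comm x x⁻¹)) ⟩
    (x⁻¹ * x) * y   ≈⟨ *-assoc x⁻¹ x y ⟩
    x⁻¹ * (x * y)   ≈⟨ *-congˡ xy≈0 ⟩
    x⁻¹ * 0#        ≈⟨ zeroʳ x⁻¹ ⟩
    0#              ∎

  *-cancelʳ-nonzero : ∀ {x y z} → ¬ z ≈ 0# → x * z ≈ y * z → x ≈ y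
  *-cancelʳ-nonzero {x} {y} {z} z≉0 xz≈yz = x∙y⁻¹≈ε⇒x≈y x y (x≉0∧x*y≈0⇒y≈0 z≉0 (begin
    z * (x - y)       ≈⟨ x[y-z]≈xy-xz z x y ⟩
    z * x - z * y     ≈⟨ x≈y⇒x∙y⁻¹≈ε (trans (*-comm z x) (trans xz≈yz (*-comm y z))) ⟩
    0#                ∎))

-- Polynomials are coefficient functions ℕ → Carrier; linTimes c w is (X + c) · w.
module Polynomials {c ℓ} (R : CommutativeRing c ℓ) (F : IsField R) where
  open CommutativeRing R hiding (zero)
  open RingArithmetic R
  open ElementarySymmetric R
  open FieldProperties R F
  open IsField F
  open UniqueS setoid using (Unique)

  linTimes : Carrier → (ℕ → Carrier) → ℕ → Carrier
  linTimes c w zero    = c * w zero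
  linTimes c w (suc m) = w m + c * w (suc m)

  linProduct : List Carrier → (ℕ → Carrier) → ℕ → Carrier
  linProduct []       w = w
  linProduct (c ∷ cs) w = linTimes c (linProduct cs w)

  one : ℕ → Carrier
  one zero    = 1#
  one (suc _) = 0#

  DegreeAtMost : ℕ → (ℕ → Carrier) → Set ℓ
  DegreeAtMost N w = ∀ m → N < m → w m ≈ 0#

  Monic : ℕ → (ℕ → Carrier) → Set ℓ
  Monic D a = a D ≈ 1# × DegreeAtMost D a

  eval : ℕ → (ℕ → Carrier) → Carrier → Carrier
  eval D a y = ∑ (suc D) (λ m → a m * y ^ m)

  linTimes-cong : ∀ {c d} {w w′ : ℕ → Carrier} → c ≈ d → (∀ m → w m ≈ w′ m) → ∀ m → linTimes c w m ≈ linTimes d w′ m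
  linTimes-cong c≈d w≈w′ zero    = *-cong c≈d (w≈w′ zero)
  linTimes-cong c≈d w≈w′ (suc m) = +-cong (w≈w′ m) (*-cong c≈d (w≈w′ (suc m)))

  linProduct-cong : ∀ {cs ds} {w w′ : ℕ → Carrier} → cs ≋ ds → (∀ m → w m ≈ w′ m) →
    ∀ m → linProduct cs w m ≈ linProduct ds w′ m
  linProduct-cong []           w≈w′ = w≈w′
  linProduct-cong (c≈d ∷ cs≋ds) w≈w′ = linTimes-cong c≈d (linProduct-cong cs≋ds w≈w′)

  linTimes-comm : ∀ c d (w : ℕ → Carrier) m → linTimes c (linTimes d w) m ≈ linTimes d (linTimes c w) m
  linTimes-comm c d w zero          = solve 3 (λ c d x → c :* (d :* x) := d :* (c :* x)) refl c d (w 0)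
  linTimes-comm c d w (suc zero)    =
    solve 4 (λ c d x y → d :* x :+ c :* (x :+ d :* y) := c :* x :+ d :* (x :+ c :* y)) refl c d (w 0) (w 1)
  linTimes-comm c d w (suc (suc m)) =
    solve 5 (λ c d x y z → (x :+ d :* y) :+ c :* (y :+ d :* z) := (x :+ c :* y) :+ d :* (y :+ c :* z))
      refl c d (w m) (w (suc m)) (w (suc (suc m)))

  linProduct-∷ʳ : ∀ cs d (w : ℕ → Carrier) m → linProduct (cs ++ d ∷ []) w m ≈ linProduct (d ∷ cs) w m
  linProduct-∷ʳ []       d w m = refl
  linProduct-∷ʳ (c ∷ cs) d w m = trans (linTimes-cong refl (linProduct-∷ʳ cs d w) m) (linTimes-comm c d (linProduct cs w) m)

  degree-linTimes : ∀ {N w} c → DegreeAtMost N w → DegreeAtMost (suc N) (linTimes c w)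
  degree-linTimes {N} {w} c deg (suc m) (s≤s N<m) = begin
    w m + c * w (suc m)   ≈⟨ +-cong (deg m N<m) (*-congˡ (deg (suc m) (ℕP.m<n⇒m<1+n N<m))) ⟩
    0# + c * 0#           ≈⟨ trans (+-identityˡ _) (zeroʳ c) ⟩
    0#                    ∎

  degree-linProduct : ∀ {N w} cs → DegreeAtMost N w → DegreeAtMost (length cs ℕ.+ N) (linProduct cs w)
  degree-linProduct []       deg = deg
  degree-linProduct (c ∷ cs) deg = degree-linTimes c (degree-linProduct cs deg)

  monic-linTimes : ∀ {N w} c → Monic N w → Monic (suc N) (linTimes c w)
  monic-linTimes {N} {w} c (lead , deg) = lead′ , degree-linTimes c deg
    where
    lead′ : w N + c * w (suc N) ≈ 1#
    lead′ = trans (+-cong lead (trans (*-congˡ (deg (suc N) ℕP.≤-refl)) (zeroʳ c))) (+-identityʳ 1#)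

  monic-linProduct : ∀ {N w} cs → Monic N w → Monic (length cs ℕ.+ N) (linProduct cs w)
  monic-linProduct []       mon = mon
  monic-linProduct (c ∷ cs) mon = monic-linTimes c (monic-linProduct cs mon)

  monic-one : Monic 0 one
  monic-one = refl , λ { (suc m) _ → refl }

  -- (X + c) · w determines w, coefficient by coefficient from the top down.
  linTimes-cancel : ∀ {N w w′} c → DegreeAtMost N w → DegreeAtMost N w′ →
    (∀ m → linTimes c w m ≈ linTimes c w′ m) → ∀ m → w m ≈ w′ m
  linTimes-cancel {N} {w} {w′} c deg deg′ eq m = fromTop (suc N) m (ℕP.m≤n+m (suc N) m)
    where
    fromTop : ∀ t m → N < m ℕ.+ t → w m ≈ w′ m
    fromTop zero    m N<m = let N<m′ = ≡.subst (N <_) (ℕP.+-identityʳ m) N<m in trans (deg m N<m′) (sym (deg′ m N<m′))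
    fromTop (suc t) m N<m = begin
      w m                               ≈⟨ x≈z//y (w m) (c * w (suc m)) _ refl ⟩
      linTimes c w (suc m) - c * w (suc m)    ≈⟨ +-cong (eq (suc m)) (-‿cong (*-congˡ above)) ⟩
      linTimes c w′ (suc m) - c * w′ (suc m)  ≈⟨ x≈z//y (w′ m) (c * w′ (suc m)) _ refl ⟨
      w′ m                              ∎
      where
      above = fromTop t (suc m) (≡.subst (N <_) (ℕP.+-suc m t) N<m)

  linProduct-cancel : ∀ {N w w′} cs → DegreeAtMost N w → DegreeAtMost N w′ →
    (∀ m → linProduct cs w m ≈ linProduct cs w′ m) → ∀ m → w m ≈ w′ m
  linProduct-cancel []       deg deg′ eq = eq
  linProduct-cancel (c ∷ cs) deg deg′ eq =
    linProduct-cancel cs deg deg′ (linTimes-cancel c (degree-linProduct cs deg) (degree-linProduct cs deg′) eq)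

  mulCoeff-cong : ∀ {a a′ b b′ : ℕ → Carrier} → (∀ i → a i ≈ a′ i) → (∀ i → b i ≈ b′ i) →
    ∀ m → mulCoeff R a b m ≈ mulCoeff R a′ b′ m
  mulCoeff-cong a≈a′ b≈b′ m = ∑-cong (suc m) (λ i _ → *-cong (a≈a′ i) (b≈b′ (m ∸ i)))

  mulCoeff-oneˡ : ∀ b m → mulCoeff R one b m ≈ b m
  mulCoeff-oneˡ b m = begin
    ∑ (suc m) (λ i → one i * b (m ∸ i))           ≈⟨ ∑-cons m _ ⟩
    1# * b m + ∑ m (λ i → 0# * b (m ∸ suc i))     ≈⟨ +-cong (*-identityˡ _) (∑-zero m _ (λ i _ → zeroˡ _)) ⟩
    b m + 0#                                       ≈⟨ +-identityʳ _ ⟩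
    b m                                            ∎

  mulCoeff-linTimesˡ : ∀ c a b m → mulCoeff R (linTimes c a) b m ≈ linTimes c (mulCoeff R a b) m
  mulCoeff-linTimesˡ c a b zero    =
    solve 3 (λ c x y → con 0 :+ (c :* x) :* y := c :* (con 0 :+ x :* y)) refl c (a 0) (b 0)
  mulCoeff-linTimesˡ c a b (suc m) = begin
    ∑ (suc (suc m)) (λ i → linTimes c a i * b (suc m ∸ i))                     ≈⟨ ∑-cons (suc m) _ ⟩
    (c * a 0) * b (suc m) + ∑ (suc m) (λ i → (a i + c * a (suc i)) * b (m ∸ i))
      ≈⟨ +-congˡ (∑-cong (suc m) (λ i _ → expand (a i) (a (suc i)) (b (m ∸ i)))) ⟩
    (c * a 0) * b (suc m) + ∑ (suc m) (λ i → a i * b (m ∸ i) + c * (a (suc i) * b (m ∸ i)))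
      ≈⟨ +-congˡ (trans (∑-distrib-+ (suc m) _ _) (+-congˡ (sym (*-distribˡ-∑ (suc m) c _)))) ⟩
    (c * a 0) * b (suc m) + (mulCoeff R a b m + c * ∑ (suc m) (λ i → a (suc i) * b (m ∸ i)))
      ≈⟨ solve 5 (λ c x y u v → c :* x :* y :+ (u :+ c :* v) := u :+ c :* (x :* y :+ v))
           refl c (a 0) (b (suc m)) (mulCoeff R a b m) _ ⟩
    mulCoeff R a b m + c * (a 0 * b (suc m) + ∑ (suc m) (λ i → a (suc i) * b (m ∸ i)))
      ≈⟨ +-congˡ (*-congˡ (sym (∑-cons (suc m) _))) ⟩
    mulCoeff R a b m + c * mulCoeff R a b (suc m)                              ∎
    where
    expand : ∀ x y z → (x + c * y) * z ≈ x * z + c * (y * z)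
    expand = solve 4 (λ c x y z → (x :+ c :* y) :* z := x :* z :+ c :* (y :* z)) refl c

  mulCoeff-linProductˡ : ∀ cs b m → mulCoeff R (linProduct cs one) b m ≈ linProduct cs b m
  mulCoeff-linProductˡ []       b m = mulCoeff-oneˡ b m
  mulCoeff-linProductˡ (c ∷ cs) b m =
    trans (mulCoeff-linTimesˡ c (linProduct cs one) b m) (linTimes-cong refl (mulCoeff-linProductˡ cs b) m)

  vieta : ∀ cs k → k ≤ length cs → linProduct cs one (length cs ∸ k) ≈ esym k cs
  vieta cs       zero    _         = trans (reflexive (≡.cong (linProduct cs one) (≡.sym (ℕP.+-identityʳ (length cs)))))
                                           (proj₁ (monic-linProduct cs monic-one))
  vieta (x ∷ xs) (suc k) (s≤s k≤N) = byTopIndex (length xs ∸ k) ≡.refl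
    where
    N = length xs
    ih : ∀ {m} → N ∸ k ≡ m → linProduct xs one m ≈ esym k xs
    ih eq = ≡.subst (λ m → linProduct xs one m ≈ esym k xs) eq (vieta xs k k≤N)
    byTopIndex : ∀ m → N ∸ k ≡ m → linProduct (x ∷ xs) one m ≈ x * esym k xs + esym (suc k) xs
    byTopIndex zero    eq = begin
      x * linProduct xs one 0           ≈⟨ *-congˡ (ih eq) ⟩
      x * esym k xs                     ≈⟨ +-identityʳ _ ⟨
      x * esym k xs + 0#                ≈⟨ +-congˡ (esym-vanishes xs (suc k) (s≤s (ℕP.m∸n≡0⇒m≤n eq))) ⟨
      x * esym k xs + esym (suc k) xs   ∎
    byTopIndex (suc m) eq = begin
      linProduct xs one m + x * linProduct xs one (suc m)   ≈⟨ +-cong ih′ (*-congˡ (ih eq)) ⟩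
      esym (suc k) xs + x * esym k xs                        ≈⟨ +-comm _ _ ⟩
      x * esym k xs + esym (suc k) xs                        ∎
      where
      k<N : k < N
      k<N = ℕP.m∸n≢0⇒n<m (λ e → ℕP.0≢1+n (≡.trans (≡.sym e) eq))
      ih′ : linProduct xs one m ≈ esym (suc k) xs
      ih′ = ≡.subst (λ m → linProduct xs one m ≈ esym (suc k) xs)
              (≡.trans (≡.sym (ℕP.pred[m∸n]≡m∸[1+n] N k)) (≡.cong ℕ.pred eq)) (vieta xs (suc k) k<N)

  eval-cong : ∀ D {a a′ : ℕ → Carrier} y → (∀ m → a m ≈ a′ m) → eval D a y ≈ eval D a′ y
  eval-cong D y a≈a′ = ∑-cong (suc D) (λ m _ → *-congʳ (a≈a′ m))

  eval-linTimes : ∀ D c (w : ℕ → Carrier) y → DegreeAtMost D w → eval (suc D) (linTimes c w) y ≈ (y + c) * eval D w y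
  eval-linTimes D c w y deg = begin
    eval (suc D) (linTimes c w) y                               ≈⟨ expand (suc D) ⟩
    (y + c) * eval D w y + c * (w (suc D) * y ^ suc D)          ≈⟨ +-congˡ (*-congˡ (*-congʳ (deg (suc D) ℕP.≤-refl))) ⟩
    (y + c) * eval D w y + c * (0# * y ^ suc D)                 ≈⟨ +-congˡ (trans (*-congˡ (zeroˡ _)) (zeroʳ c)) ⟩
    (y + c) * eval D w y + 0#                                   ≈⟨ +-identityʳ _ ⟩
    (y + c) * eval D w y                                        ∎
    where
    expand : ∀ N → ∑ (suc N) (λ m → linTimes c w m * y ^ m) ≈ (y + c) * ∑ N (λ m → w m * y ^ m) + c * (w N * y ^ N)
    expand zero    = solve 4 (λ y c x p → con 0 :+ (c :* x) :* p := (y :+ c) :* con 0 :+ c :* (x :* p)) refl y c (w 0) 1#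
    expand (suc N) = begin
      ∑ (suc N) (λ m → linTimes c w m * y ^ m) + (w N + c * w (suc N)) * (y * y ^ N)       ≈⟨ +-congʳ (expand N) ⟩
      ((y + c) * s + c * (w N * y ^ N)) + (w N + c * w (suc N)) * (y * y ^ N)
        ≈⟨ solve 6 (λ y c s a b p → ((y :+ c) :* s :+ c :* (a :* p)) :+ (a :+ c :* b) :* (y :* p)
                                  := (y :+ c) :* (s :+ a :* p) :+ c :* (b :* (y :* p)))
             refl y c s (w N) (w (suc N)) (y ^ N) ⟩
      (y + c) * (s + w N * y ^ N) + c * (w (suc N) * (y * y ^ N))                           ∎
      where s = ∑ N (λ m → w m * y ^ m)

  -- Synthetic division by X - b: the quotient has coefficients ∑_{t < D - m} a (m + 1 + t) bᵗ.
  module SyntheticDivision (D : ℕ) (a : ℕ → Carrier) (b : Carrier) (deg : DegreeAtMost D a) where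
    tailSum : ℕ → ℕ → Carrier
    tailSum k m = ∑ k (λ t → a (suc m ℕ.+ t) * b ^ t)

    quotient : ℕ → Carrier
    quotient m = tailSum (D ∸ m) m

    quotient-degree : DegreeAtMost (ℕ.pred D) quotient
    quotient-degree m pred[D]<m = reflexive (≡.cong (λ k → tailSum k m) (ℕP.m≤n⇒m∸n≡0 (D≤m D pred[D]<m)))
      where
      D≤m : ∀ D → ℕ.pred D < m → D ≤ m
      D≤m zero    _  = z≤n
      D≤m (suc D) lt = lt

    shift : ∀ k m → tailSum (suc k) m ≈ a (suc m) + b * tailSum k (suc m)
    shift k m = begin
      tailSum (suc k) m                                                  ≈⟨ ∑-cons k _ ⟩
      a (suc m ℕ.+ 0) * 1# + ∑ k (λ t → a (suc m ℕ.+ suc t) * (b * b ^ t))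
        ≈⟨ +-cong (trans (*-identityʳ _) (reflexive (≡.cong (a ∘ suc) (ℕP.+-identityʳ m))))
                  (∑-cong k (λ t _ → trans (*-congʳ (reflexive (≡.cong a (ℕP.+-suc (suc m) t)))) (x∙yz≈y∙xz _ b _))) ⟩
      a (suc m) + ∑ k (λ t → b * (a (suc (suc m) ℕ.+ t) * b ^ t))         ≈⟨ +-congˡ (*-distribˡ-∑ k b _) ⟨
      a (suc m) + b * tailSum k (suc m)                                  ∎

    quotient-step : ∀ m → quotient m ≈ a (suc m) + b * quotient (suc m)
    quotient-step m with D ∸ m in eq
    ... | zero  = begin
      0#                                  ≈⟨ +-identityʳ 0# ⟨
      0# + 0#                             ≈⟨ +-cong (sym (deg (suc m) (s≤s D≤m))) (sym (trans (*-congˡ vanish) (zeroʳ b))) ⟩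
      a (suc m) + b * quotient (suc m)    ∎
      where
      D≤m = ℕP.m∸n≡0⇒m≤n eq
      vanish : quotient (suc m) ≈ 0#
      vanish = quotient-degree (suc m) (s≤s (ℕP.≤-trans ℕP.pred[n]≤n D≤m))
    ... | suc k = trans (shift k m) (+-congˡ (*-congˡ (reflexive (≡.cong (λ k → tailSum k (suc m)) k≡))))
      where
      k≡ : k ≡ D ∸ suc m
      k≡ = ≡.trans (≡.cong ℕ.pred (≡.sym eq)) (ℕP.pred[m∸n]≡m∸[1+n] D m)

    eval≈a₀+b*quotient₀ : eval D a b ≈ a 0 + b * quotient 0
    eval≈a₀+b*quotient₀ = begin
      ∑ (suc D) (λ m → a m * b ^ m)                      ≈⟨ ∑-cons D _ ⟩
      a 0 * 1# + ∑ D (λ t → a (suc t) * (b * b ^ t))     ≈⟨ +-cong (*-identityʳ _) (∑-cong D (λ t _ → x∙yz≈y∙xz _ b _)) ⟩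
      a 0 + ∑ D (λ t → b * (a (suc t) * b ^ t))          ≈⟨ +-congˡ (*-distribˡ-∑ D b _) ⟨
      a 0 + b * quotient 0                               ∎

  divideByRoot : ∀ D a b → Monic (suc D) a → eval (suc D) a b ≈ 0# →
    Σ (ℕ → Carrier) λ g → Monic D g × (∀ m → a m ≈ linTimes (- b) g m)
  divideByRoot D a b (lead , deg) root = quotient , (quotient-lead , quotient-degree) , coefficients
    where
    open SyntheticDivision (suc D) a b deg
    quotient-lead : quotient D ≈ 1#
    quotient-lead = begin
      quotient D                            ≈⟨ quotient-step D ⟩
      a (suc D) + b * quotient (suc D)      ≈⟨ +-cong lead (trans (*-congˡ (quotient-degree (suc D) ℕP.≤-refl)) (zeroʳ b)) ⟩
      1# + 0#                               ≈⟨ +-identityʳ 1# ⟩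
      1#                                    ∎
    coefficients : ∀ m → a m ≈ linTimes (- b) quotient m
    coefficients zero    = begin
      a 0                       ≈⟨ x≈z//y (a 0) (b * quotient 0) 0# (trans (sym eval≈a₀+b*quotient₀) root) ⟩
      0# - b * quotient 0       ≈⟨ trans (+-identityˡ _) (-‿distribˡ-* b (quotient 0)) ⟩
      - b * quotient 0          ∎
    coefficients (suc m) = begin
      a (suc m)                                   ≈⟨ x≈z//y (a (suc m)) (b * quotient (suc m)) _ (sym (quotient-step m)) ⟩
      quotient m - b * quotient (suc m)           ≈⟨ +-congˡ (-‿distribˡ-* b (quotient (suc m))) ⟩
      quotient m + - b * quotient (suc m)         ∎

  noRoot-monic-degree0 : ∀ {a} y → Monic 0 a → ¬ eval 0 a y ≈ 0#
  noRoot-monic-degree0 {a} y (lead , _) root = 0≉1 (begin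
    0#             ≈⟨ root ⟨
    0# + a 0 * 1#  ≈⟨ trans (+-identityˡ _) (*-identityʳ _) ⟩
    a 0            ≈⟨ lead ⟩
    1#             ∎)

  record Factorisation (D : ℕ) (a : ℕ → Carrier) (roots : List Carrier) : Set (c ⊔ ℓ) where
    field
      roots≤degree   : length roots ≤ D
      quotient       : ℕ → Carrier
      quotient-monic : Monic (D ∸ length roots) quotient
      factorisation  : ∀ m → a m ≈ linProduct (map -_ roots) quotient m

  factorRoots : ∀ D a roots → Monic D a → Unique roots → All (λ y → eval D a y ≈ 0#) roots → Factorisation D a roots
  factorRoots D       a []       mon _ _ = record
    { roots≤degree = z≤n ; quotient = a ; quotient-monic = mon ; factorisation = λ _ → refl }
  factorRoots zero    a (b ∷ bs) mon _ (root ∷ _) = ⊥-elim (noRoot-monic-degree0 b mon root)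
  factorRoots (suc D) a (b ∷ bs) mon (b≉bs ∷ unique) (root ∷ roots) with divideByRoot D a b mon root
  ... | g , g-monic , a≈[X-b]g = record
    { roots≤degree   = s≤s roots≤degree
    ; quotient       = quotient
    ; quotient-monic = quotient-monic
    ; factorisation  = λ m → trans (a≈[X-b]g m) (linTimes-cong refl factorisation m)
    }
    where
    eval-a : ∀ y → eval (suc D) a y ≈ (y - b) * eval D g y
    eval-a y = trans (eval-cong (suc D) y a≈[X-b]g) (eval-linTimes D (- b) g y (proj₂ g-monic))
    rootsOfQuotient : All (λ y → eval D g y ≈ 0#) bs
    rootsOfQuotient = All.zipWith
      (λ { {y} (b≉y , root) → x≉0∧x*y≈0⇒y≈0 (λ y-b≈0 → b≉y (sym (x∙y⁻¹≈ε⇒x≈y y b y-b≈0))) (trans (sym (eval-a y)) root) })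
      (b≉bs , roots)
    open Factorisation (factorRoots D g bs g-monic unique rootsOfQuotient)

-- Stated for maps preserving ≈, +, * and 1 rather than for IsRingHom, so that it also covers
-- the Frobenius maps x ↦ x ^ qᵗ, whose additivity is a theorem.
module HomomorphismProperties {c ℓ c′ ℓ′} (A : CommutativeRing c ℓ) (B : CommutativeRing c′ ℓ′)
  (φ : CommutativeRing.Carrier A → CommutativeRing.Carrier B)
  (φ-cong : ∀ {x y} → CommutativeRing._≈_ A x y → CommutativeRing._≈_ B (φ x) (φ y))
  (φ-+ : ∀ x y → CommutativeRing._≈_ B (φ (CommutativeRing._+_ A x y)) (CommutativeRing._+_ B (φ x) (φ y)))
  (φ-* : ∀ x y → CommutativeRing._≈_ B (φ (CommutativeRing._*_ A x y)) (CommutativeRing._*_ B (φ x) (φ y)))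
  (φ-1 : CommutativeRing._≈_ B (φ (CommutativeRing.1# A)) (CommutativeRing.1# B))
  where
  module A = CommutativeRing A
  module A′ = RingArithmetic A
  open CommutativeRing B hiding (zero)
  open RingArithmetic B
  open ElementarySymmetric B using (esym)
  open ElementarySymmetric A using () renaming (esym to esymᴬ)

  φ-0 : φ A.0# ≈ 0#
  φ-0 = +-cancelʳ (φ A.0#) _ _ (begin
    φ A.0# + φ A.0#       ≈⟨ φ-+ A.0# A.0# ⟨
    φ (A.0# A.+ A.0#)     ≈⟨ φ-cong (A.+-identityˡ A.0#) ⟩
    φ A.0#                ≈⟨ +-identityˡ _ ⟨
    0# + φ A.0#           ∎)

  φ-neg : ∀ x → φ (A.- x) ≈ - φ x
  φ-neg x = +-inverseˡ-unique (φ (A.- x)) (φ x)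
    (trans (sym (φ-+ (A.- x) x)) (trans (φ-cong (A.-‿inverseˡ x)) φ-0))

  φ-^ : ∀ x m → φ (x A′.^ m) ≈ φ x ^ m
  φ-^ x zero    = φ-1
  φ-^ x (suc m) = trans (φ-* _ _) (*-congˡ (φ-^ x m))

  φ-∑ : ∀ N f → φ (A′.∑ N f) ≈ ∑ N (φ ∘ f)
  φ-∑ zero    f = φ-0
  φ-∑ (suc N) f = trans (φ-+ _ _) (+-congʳ (φ-∑ N f))

  φ-fromℕ : ∀ m → φ (fromℕ A m) ≈ fromℕ B m
  φ-fromℕ zero    = φ-0
  φ-fromℕ (suc m) = trans (φ-+ _ _) (+-cong φ-1 (φ-fromℕ m))

  φ-esym : ∀ j xs → φ (esymᴬ j xs) ≈ esym j (map φ xs)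
  φ-esym zero    xs       = φ-1
  φ-esym (suc j) []       = φ-0
  φ-esym (suc j) (x ∷ xs) = trans (φ-+ _ _) (+-cong (trans (φ-* _ _) (*-congˡ (φ-esym j xs))) (φ-esym (suc j) xs))

  φ-mulCoeff : ∀ a b m → φ (mulCoeff A a b m) ≈ mulCoeff B (φ ∘ a) (φ ∘ b) m
  φ-mulCoeff a b m = trans (φ-∑ (suc m) _) (∑-cong (suc m) (λ i _ → φ-* (a i) (b (m ∸ i))))

  φ-eval : ∀ D (a : ℕ → A.Carrier) y → φ (A′.∑ (suc D) (λ m → a m A.* y A′.^ m)) ≈ ∑ (suc D) (λ m → φ (a m) * φ y ^ m)
  φ-eval D a y = trans (φ-∑ (suc D) _) (∑-cong (suc D) (λ i _ → trans (φ-* (a i) _) (*-congˡ (φ-^ y i))))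

module MonicCoeff {c ℓ} (R : CommutativeRing c ℓ) where
  open CommutativeRing R

  monicCoeff-< : ∀ {d m} (g : ℕ → Carrier) → m < d → monicCoeff R d g m ≡ g m
  monicCoeff-< {d} {m} g m<d with m ℕ.<ᵇ d | ℕP.<⇒<ᵇ m<d
  ... | true | _ = ≡.refl

  monicCoeff-≡ : ∀ d (g : ℕ → Carrier) → monicCoeff R d g d ≡ 1#
  monicCoeff-≡ d g with d ℕ.<ᵇ d in lt | d ℕ.≡ᵇ d | ℕP.≡⇒≡ᵇ d d ≡.refl
  ... | false | true | _ = ≡.refl
  ... | true  | _    | _ = ⊥-elim (ℕP.<-irrefl ≡.refl (ℕP.<ᵇ⇒< d d (≡.subst T (≡.sym lt) tt)))

  monicCoeff-> : ∀ {d m} (g : ℕ → Carrier) → d < m → monicCoeff R d g m ≡ 0#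
  monicCoeff-> {d} {m} g d<m with m ℕ.<ᵇ d in lt | m ℕ.≡ᵇ d in eq
  ... | false | false = ≡.refl
  ... | true  | _     = ⊥-elim (ℕP.<-asym d<m (ℕP.<ᵇ⇒< m d (≡.subst T (≡.sym lt) tt)))
  ... | false | true  = ⊥-elim (ℕP.<⇒≢ d<m (≡.sym (ℕP.≡ᵇ⇒≡ m d (≡.subst T (≡.sym eq) tt))))

module FiniteField {c ℓ} (R : CommutativeRing c ℓ) (F : IsField R) {N : ℕ} (H : HasCard R N) where
  open CommutativeRing R hiding (zero)
  open RingArithmetic R
  open IsField F
  open HasCard H
  open FieldProperties R F
  module ΣF = Sum +-commutativeMonoid
  module ΠF = Sum *-commutativeMonoid

  infix 4 _≟_
  _≟_ : ∀ x y → Dec (x ≈ y)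
  x ≟ y with to x FinP.≟ to y
  ... | yes eq  = yes (trans (sym (from-to x)) (trans (reflexive (≡.cong from eq)) (from-to y)))
  ... | no  neq = no (neq ∘ to-cong)

  from-injective : ∀ {i j} → from i ≈ from j → i ≡ j
  from-injective {i} {j} eq = ≡.trans (≡.sym (to-from i)) (≡.trans (to-cong eq) (to-from j))

  x^n≈0⇒x≈0 : ∀ x n → x ^ n ≈ 0# → x ≈ 0#
  x^n≈0⇒x≈0 x zero    1≈0 = ⊥-elim (0≉1 (sym 1≈0))
  x^n≈0⇒x≈0 x (suc n) xxⁿ≈0 with x ≟ 0#
  ... | yes x≈0 = x≈0
  ... | no  x≉0 = x^n≈0⇒x≈0 x n (x≉0∧x*y≈0⇒y≈0 x≉0 xxⁿ≈0)

  card-suc : Σ ℕ λ N′ → N ≡ suc N′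
  card-suc = predecessor (to 0#)
    where
    predecessor : ∀ {n} → Fin n → Σ ℕ λ m → n ≡ suc m
    predecessor {suc m} _ = m , ≡.refl

  bijection⇒permutation : (f g : Carrier → Carrier) → (∀ {x y} → x ≈ y → f x ≈ f y) → (∀ {x y} → x ≈ y → g x ≈ g y) →
    (∀ x → f (g x) ≈ x) → (∀ x → g (f x) ≈ x) → Permutation N N
  bijection⇒permutation f g f-cong g-cong fg gf =
    permutation (λ i → to (f (from i))) (λ i → to (g (from i))) (isInverse f g f-cong fg) (isInverse g f g-cong gf)
    where
    isInverse : (f g : Carrier → Carrier) → (∀ {x y} → x ≈ y → f x ≈ f y) → (∀ x → f (g x) ≈ x) →
      ∀ i → to (f (from (to (g (from i))))) ≡ i
    isInverse f g f-cong fg i = ≡.trans (to-cong (trans (f-cong (from-to _)) (fg (from i)))) (to-from i)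

  -- Translation by 1 permutes the field, so ∑ y = ∑ (1 + y) = N · 1 + ∑ y.
  fromℕ-card≈0 : fromℕ R N ≈ 0#
  fromℕ-card≈0 = +-cancelʳ (ΣF.sum from) _ _ (begin
    fromℕ R N + ΣF.sum from                ≈⟨ +-congʳ (∑-const N) ⟨
    ΣF.sum {N} (λ _ → 1#) + ΣF.sum from     ≈⟨ ΣF.∑-distrib-+ (λ _ → 1#) from ⟨
    ΣF.sum (λ i → 1# + from i)             ≈⟨ ΣF.sum-cong-≋ {N} (λ i → sym (from-to _)) ⟩
    ΣF.sum (λ i → from (to (1# + from i))) ≈⟨ ΣF.∑-permute from translation ⟨
    ΣF.sum from                            ≈⟨ +-identityˡ _ ⟨
    0# + ΣF.sum from                       ∎)
    where
    ∑-const : ∀ n → ΣF.sum {n} (λ _ → 1#) ≈ fromℕ R n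
    ∑-const zero    = refl
    ∑-const (suc n) = +-congˡ (∑-const n)
    translation = bijection⇒permutation (1# +_) (- 1# +_) +-congˡ +-congˡ
      (λ x → trans (sym (+-assoc _ _ _)) (trans (+-congʳ (-‿inverseʳ 1#)) (+-identityˡ x)))
      (λ x → trans (sym (+-assoc _ _ _)) (trans (+-congʳ (-‿inverseˡ 1#)) (+-identityˡ x)))

  ∏-nonzero : ∀ {n} (f : Fin n → Carrier) → (∀ i → ¬ f i ≈ 0#) → ¬ ΠF.sum f ≈ 0#
  ∏-nonzero {zero}  f f≉0 ∏≈0 = 0≉1 (sym ∏≈0)
  ∏-nonzero {suc n} f f≉0 ∏≈0 = ∏-nonzero (f ∘ Fin.suc) (f≉0 ∘ Fin.suc) (x≉0∧x*y≈0⇒y≈0 (f≉0 Fin.zero) ∏≈0)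

  ∏-allButOne : ∀ {n} x (t : Fin (suc n) → Carrier) i → t i ≈ 1# → (∀ j → j ≢ i → t j ≈ x) → ΠF.sum t ≈ x ^ n
  ∏-allButOne {n} x t i tᵢ≈1 others = begin
    ΠF.sum t                             ≈⟨ ΠF.sum-remove t ⟩
    t i * ΠF.sum (removeAt t i)          ≈⟨ *-cong tᵢ≈1 (ΠF.sum-cong-≋ (λ j → others (Fin.punchIn i j) (FinP.punchInᵢ≢i i j))) ⟩
    1# * ΠF.sum {n} (λ _ → x)            ≈⟨ trans (*-identityˡ _) (∏-const n) ⟩
    x ^ n                               ∎
    where
    ∏-const : ∀ n → ΠF.sum {n} (λ _ → x) ≈ x ^ n
    ∏-const zero    = refl
    ∏-const (suc n) = *-congˡ (∏-const n)

  -- Multiplication by x ≉ 0 permutes the field; comparing the products of the nonzero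
  -- elements before and after the permutation gives x ^ (N - 1) ≈ 1.
  x^card≈x : ∀ x → x ^ N ≈ x
  x^card≈x x with card-suc
  ... | N′ , ≡.refl with x ≟ 0#
  ...   | yes x≈0 = trans (*-congʳ x≈0) (trans (zeroˡ _) (sym x≈0))
  ...   | no  x≉0 = trans (*-congˡ x^N′≈1) (*-identityʳ x)
    where
    nonzeroPart : Carrier → Carrier
    nonzeroPart y with y ≟ 0#
    ... | yes _ = 1#
    ... | no  _ = y

    scale : Carrier → Carrier
    scale y with y ≟ 0#
    ... | yes _ = 1#
    ... | no  _ = x

    nonzeroPart≉0 : ∀ y → ¬ nonzeroPart y ≈ 0#
    nonzeroPart≉0 y with y ≟ 0#
    ... | yes _   = λ 1≈0 → 0≉1 (sym 1≈0)
    ... | no  y≉0 = y≉0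

    nonzeroPart-cong : ∀ {y z} → y ≈ z → nonzeroPart y ≈ nonzeroPart z
    nonzeroPart-cong {y} {z} y≈z with y ≟ 0# | z ≟ 0#
    ... | yes _   | yes _   = refl
    ... | yes y≈0 | no  z≉0 = ⊥-elim (z≉0 (trans (sym y≈z) y≈0))
    ... | no  y≉0 | yes z≈0 = ⊥-elim (y≉0 (trans y≈z z≈0))
    ... | no  _   | no  _   = y≈z

    nonzeroPart-* : ∀ y → nonzeroPart (x * y) ≈ scale y * nonzeroPart y
    nonzeroPart-* y with x * y ≟ 0# | y ≟ 0#
    ... | yes _    | yes _   = sym (*-identityˡ 1#)
    ... | yes xy≈0 | no  y≉0 = ⊥-elim (y≉0 (x≉0∧x*y≈0⇒y≈0 x≉0 xy≈0))
    ... | no  xy≉0 | yes y≈0 = ⊥-elim (xy≉0 (trans (*-congˡ y≈0) (zeroʳ x)))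
    ... | no  _    | no  _   = refl

    scale-0 : scale (from (to 0#)) ≈ 1#
    scale-0 with from (to 0#) ≟ 0#
    ... | yes _ = refl
    ... | no  0≉0 = ⊥-elim (0≉0 (from-to 0#))

    scale-others : ∀ i → i ≢ to 0# → scale (from i) ≈ x
    scale-others i i≢0 with from i ≟ 0#
    ... | yes i≈0 = ⊥-elim (i≢0 (≡.trans (≡.sym (to-from i)) (to-cong i≈0)))
    ... | no  _   = refl

    dilation = bijection⇒permutation (x *_) (x⁻¹ *_) *-congˡ *-congˡ
      (λ y → trans (sym (*-assoc _ _ _)) (trans (*-congʳ xx⁻¹≈1) (*-identityˡ y)))
      (λ y → trans (sym (*-assoc _ _ _)) (trans (*-congʳ (trans (*-comm x⁻¹ x) xx⁻¹≈1)) (*-identityˡ y)))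
      where open Σ (inverse x x≉0) renaming (proj₁ to x⁻¹; proj₂ to xx⁻¹≈1)

    ∏nonzero = ΠF.sum (nonzeroPart ∘ from)

    ∏scale≈1 : ΠF.sum (scale ∘ from) ≈ 1#
    ∏scale≈1 = *-cancelʳ-nonzero (∏-nonzero _ (nonzeroPart≉0 ∘ from)) (begin
      ΠF.sum (scale ∘ from) * ∏nonzero                     ≈⟨ ΠF.∑-distrib-+ (scale ∘ from) (nonzeroPart ∘ from) ⟨
      ΠF.sum (λ i → scale (from i) * nonzeroPart (from i)) ≈⟨ ΠF.sum-cong-≋ {suc N′} (λ i → sym (nonzeroPart-* (from i))) ⟩
      ΠF.sum (λ i → nonzeroPart (x * from i))              ≈⟨ ΠF.sum-cong-≋ {suc N′} (λ i → nonzeroPart-cong (sym (from-to (x * from i)))) ⟩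
      ΠF.sum (λ i → nonzeroPart (from (to (x * from i))))  ≈⟨ ΠF.∑-permute (nonzeroPart ∘ from) dilation ⟨
      ∏nonzero                                             ≈⟨ *-identityˡ _ ⟨
      1# * ∏nonzero                                        ∎)

    x^N′≈1 : x ^ N′ ≈ 1#
    x^N′≈1 = trans (sym (∏-allButOne x (scale ∘ from) (to 0#) scale-0 scale-others)) ∏scale≈1

module FreshmansDream {c ℓ} (R : CommutativeRing c ℓ) where
  open CommutativeRing R hiding (zero)
  open RingArithmetic R
  module Binomialᴿ = Binomial commutativeSemiring
  open import Algebra.Properties.Semiring.Exp semiring using () renaming (_^_ to _^′_)
  open import Algebra.Properties.Semiring.Mult semiring using () renaming (_×_ to _×′_)
  open import Algebra.Definitions.RawMonoid +-rawMonoid using (sum)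

  ^′≈^ : ∀ x n → x ^′ n ≈ x ^ n
  ^′≈^ x zero    = refl
  ^′≈^ x (suc n) = *-congˡ (^′≈^ x n)

  ×′≈fromℕ* : ∀ n z → n ×′ z ≈ fromℕ R n * z
  ×′≈fromℕ* zero    z = sym (zeroˡ z)
  ×′≈fromℕ* (suc n) z = trans (+-congˡ (×′≈fromℕ* n z)) (sym (trans (distribʳ z 1# (fromℕ R n)) (+-congʳ (*-identityˡ z))))

  sum-last : ∀ n (t : Fin (suc n) → Carrier) → (∀ (i : Fin n) → t (inject₁ i) ≈ 0#) → sum t ≈ t (Fin.fromℕ n)
  sum-last zero    t _    = +-identityʳ _
  sum-last (suc n) t t≈0 = trans (+-cong (t≈0 Fin.zero) (sum-last n (t ∘ Fin.suc) (t≈0 ∘ Fin.suc))) (+-identityˡ _)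

  -- All inner binomial coefficients of a prime p are divisible by p.
  frobenius-+ : ∀ p → Prime p → fromℕ R p ≈ 0# → ∀ x y → (x + y) ^ p ≈ x ^ p + y ^ p
  frobenius-+ zero          pr _     = ⊥-elim (¬prime[0] pr)
  frobenius-+ (suc zero)    pr _     = ⊥-elim (¬prime[1] pr)
  frobenius-+ (suc (suc m)) pr p·1≈0 x y = begin
    (x + y) ^ p                            ≈⟨ ^′≈^ (x + y) p ⟨
    (x + y) ^′ p                           ≈⟨ Binomialᴿ.theorem p x y ⟩
    sum term                               ≈⟨ +-congˡ (sum-last (suc m) (term ∘ Fin.suc) inner≈0) ⟩
    term Fin.zero + term (Fin.fromℕ p)     ≈⟨ +-cong term₀ termₚ ⟩
    y ^ p + x ^ p                          ≈⟨ +-comm _ _ ⟩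
    x ^ p + y ^ p                          ∎
    where
    p = suc (suc m)
    term = Binomialᴿ.binomialTerm x y p
    monomial : ℕ → Carrier
    monomial k = x ^′ k * y ^′ (p ∸ k)
    term≈ : ∀ k → (p C k) ×′ monomial k ≈ fromℕ R (p C k) * monomial k
    term≈ k = ×′≈fromℕ* (p C k) (monomial k)
    inner≈0 : ∀ (i : Fin (suc m)) → term (Fin.suc (inject₁ i)) ≈ 0#
    inner≈0 i with prime∣pCk pr (s≤s z≤n) (s≤s (FinP.toℕ<n i))
    ... | divides q pCk≡q*p = begin
      term (Fin.suc (inject₁ i))
        ≈⟨ trans (reflexive (≡.cong (λ k → (p C k) ×′ monomial k) (≡.cong suc (FinP.toℕ-inject₁ i)))) (term≈ k) ⟩
      fromℕ R (p C k) * monomial k               ≈⟨ *-congʳ (trans (reflexive (≡.cong (fromℕ R) pCk≡q*p)) (fromℕ-* q p)) ⟩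
      (fromℕ R q * fromℕ R p) * monomial k       ≈⟨ *-congʳ (trans (*-congˡ p·1≈0) (zeroʳ _)) ⟩
      0# * monomial k                            ≈⟨ zeroˡ _ ⟩
      0#                                         ∎
      where k = suc (toℕ i)
    term₀ : term Fin.zero ≈ y ^ p
    term₀ = begin
      term Fin.zero                      ≈⟨ term≈ 0 ⟩
      fromℕ R (p C 0) * (1# * y ^′ p)    ≈⟨ *-congʳ (reflexive (≡.cong (fromℕ R) (≡.trans (nCk≡nC[n∸k] {0} {p} z≤n) (nCn≡1 p)))) ⟩
      (1# + 0#) * (1# * y ^′ p)          ≈⟨ trans (*-congʳ (+-identityʳ 1#)) (trans (*-identityˡ _) (*-identityˡ _)) ⟩
      y ^′ p                             ≈⟨ ^′≈^ y p ⟩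
      y ^ p                              ∎
    termₚ : term (Fin.fromℕ p) ≈ x ^ p
    termₚ = begin
      term (Fin.fromℕ p)                 ≈⟨ trans (reflexive (≡.cong (λ k → (p C k) ×′ monomial k) (FinP.toℕ-fromℕ p))) (term≈ p) ⟩
      fromℕ R (p C p) * (x ^′ p * y ^′ (p ∸ p))
        ≈⟨ *-cong (reflexive (≡.cong (fromℕ R) (nCn≡1 p))) (*-congˡ (reflexive (≡.cong (y ^′_) (ℕP.n∸n≡0 p)))) ⟩
      (1# + 0#) * (x ^′ p * 1#)          ≈⟨ trans (*-congʳ (+-identityʳ 1#)) (trans (*-identityˡ _) (*-identityʳ _)) ⟩
      x ^′ p                             ≈⟨ ^′≈^ x p ⟩
      x ^ p                              ∎

  frobenius-+-iterate : ∀ p → Prime p → fromℕ R p ≈ 0# → ∀ s x y → (x + y) ^ (p ℕ.^ s) ≈ x ^ (p ℕ.^ s) + y ^ (p ℕ.^ s)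
  frobenius-+-iterate p pr p·1≈0 zero    x y = distribʳ 1# x y
  frobenius-+-iterate p pr p·1≈0 (suc s) x y = begin
    (x + y) ^ (p ℕ.* p ℕ.^ s)              ≈⟨ ^-assocʳ (x + y) p (p ℕ.^ s) ⟩
    ((x + y) ^ p) ^ (p ℕ.^ s)              ≈⟨ ^-congˡ (p ℕ.^ s) (frobenius-+ p pr p·1≈0 x y) ⟩
    (x ^ p + y ^ p) ^ (p ℕ.^ s)            ≈⟨ frobenius-+-iterate p pr p·1≈0 s (x ^ p) (y ^ p) ⟩
    (x ^ p) ^ (p ℕ.^ s) + (y ^ p) ^ (p ℕ.^ s)    ≈⟨ +-cong (^-assocʳ x p (p ℕ.^ s)) (^-assocʳ y p (p ℕ.^ s)) ⟨
    x ^ (p ℕ.* p ℕ.^ s) + y ^ (p ℕ.* p ℕ.^ s)    ∎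

module FixedField {c ℓ c′ ℓ′} (K : CommutativeRing c ℓ) (FK : IsField K) {q : ℕ} (HK : HasCard K q) (2≤q : 2 ≤ q)
  (L : CommutativeRing c′ ℓ′) (FL : IsField L) {N : ℕ} (HL : HasCard L N)
  (ι : CommutativeRing.Carrier K → CommutativeRing.Carrier L) (hom : IsRingHom K L ι) where
  module K = CommutativeRing K
  open CommutativeRing L hiding (zero)
  open RingArithmetic L
  open Polynomials L FL
  open RingMorphisms.IsRingHomomorphism hom using (⟦⟧-cong; +-homo; *-homo; 0#-homo; 1#-homo; -‿homo)
  module FiniteK = FiniteField K FK HK
  module ιH = HomomorphismProperties K L ι ⟦⟧-cong +-homo *-homo 1#-homo
  open MonicCoeff K
  open FiniteField L FL HL using (_≟_)

  ι-injective : ∀ {x y} → ι x ≈ ι y → x K.≈ y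
  ι-injective {x} {y} ιx≈ιy with x FiniteK.≟ y
  ... | yes x≈y = x≈y
  ... | no  x≉y with IsField.inverse FK (x K.- y) (x≉y ∘ RingArithmetic.x∙y⁻¹≈ε⇒x≈y K x y)
  ...   | z , [x-y]z≈1 = ⊥-elim (IsField.0≉1 FL (begin
    0#                      ≈⟨ zeroˡ (ι z) ⟨
    0# * ι z                ≈⟨ *-congʳ (x≈y⇒x∙y⁻¹≈ε ιx≈ιy) ⟨
    (ι x - ι y) * ι z       ≈⟨ *-congʳ (trans (+-homo x (K.- y)) (+-congˡ (-‿homo y))) ⟨
    ι (x K.- y) * ι z       ≈⟨ *-homo _ _ ⟨
    ι ((x K.- y) K.* z)     ≈⟨ ⟦⟧-cong [x-y]z≈1 ⟩
    ι K.1#                  ≈⟨ 1#-homo ⟩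
    1#                      ∎))

  δ : ℕ → ℕ → Carrier
  δ t m with t ℕ.≟ m
  ... | yes _ = 1#
  ... | no  _ = 0#

  δ-≢ : ∀ {t m} → t ≢ m → δ t m ≈ 0#
  δ-≢ {t} {m} t≢m with t ℕ.≟ m
  ... | yes t≡m = ⊥-elim (t≢m t≡m)
  ... | no  _   = refl

  δ-refl : ∀ t → δ t t ≈ 1#
  δ-refl t with t ℕ.≟ t
  ... | yes _   = refl
  ... | no  t≢t = ⊥-elim (t≢t ≡.refl)

  ∑-δ : ∀ M t (g : ℕ → Carrier) → t < M → ∑ M (λ m → δ t m * g m) ≈ g t
  ∑-δ (suc M) t g t<1+M with ℕP.m≤n⇒m<n∨m≡n (ℕP.≤-pred t<1+M)
  ... | inj₁ t<M     = trans (+-cong (∑-δ M t g t<M) (trans (*-congʳ (δ-≢ (ℕP.<⇒≢ t<M))) (zeroˡ _))) (+-identityʳ _)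
  ... | inj₂ ≡.refl = begin
    ∑ t (λ m → δ t m * g m) + δ t t * g t   ≈⟨ +-cong (∑-zero t _ (λ m m<t → trans (*-congʳ (δ-≢ (ℕP.>⇒≢ m<t))) (zeroˡ _)))
                                                        (*-congʳ (δ-refl t)) ⟩
    0# + 1# * g t                           ≈⟨ trans (+-identityˡ _) (*-identityˡ _) ⟩
    g t                                     ∎

  Xᵠ-X : ℕ → Carrier
  Xᵠ-X m = δ q m - δ 1 m

  Xᵠ-X-monic : Monic q Xᵠ-X
  Xᵠ-X-monic = lead , degree
    where
    lead : δ q q - δ 1 q ≈ 1#
    lead = trans (+-cong (δ-refl q) (trans (-‿cong (δ-≢ (ℕP.<⇒≢ 2≤q))) -0#≈0#)) (+-identityʳ 1#)
    degree : DegreeAtMost q Xᵠ-X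
    degree m q<m = trans (+-cong (δ-≢ (ℕP.<⇒≢ q<m)) (trans (-‿cong (δ-≢ (ℕP.<⇒≢ (ℕP.<-trans 2≤q q<m)))) -0#≈0#))
                         (+-identityʳ 0#)

  eval-Xᵠ-X : ∀ z → eval q Xᵠ-X z ≈ z ^ q - z
  eval-Xᵠ-X z = begin
    ∑ (suc q) (λ m → (δ q m - δ 1 m) * z ^ m)
      ≈⟨ ∑-cong (suc q) (λ m _ → trans (distribʳ _ _ _) (+-congˡ (sym (-‿distribˡ-* _ _)))) ⟩
    ∑ (suc q) (λ m → δ q m * z ^ m + - (δ 1 m * z ^ m))            ≈⟨ ∑-distrib-+ (suc q) _ _ ⟩
    ∑ (suc q) (λ m → δ q m * z ^ m) + ∑ (suc q) (λ m → - (δ 1 m * z ^ m))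
      ≈⟨ +-cong (∑-δ (suc q) q _ ℕP.≤-refl) (∑-neg (suc q) _) ⟩
    z ^ q - ∑ (suc q) (λ m → δ 1 m * z ^ m)                        ≈⟨ +-congˡ (-‿cong (∑-δ (suc q) 1 _ (s≤s (ℕP.<⇒≤ 2≤q)))) ⟩
    z ^ q - z * 1#                                                 ≈⟨ +-congˡ (-‿cong (*-identityʳ z)) ⟩
    z ^ q - z                                                      ∎
    where
    ∑-neg : ∀ M (f : ℕ → Carrier) → ∑ M (λ m → - f m) ≈ - ∑ M f
    ∑-neg zero    f = sym -0#≈0#
    ∑-neg (suc M) f = trans (+-congʳ (∑-neg M f)) (-‿+-comm (∑ M f) (f M))

  fixed-ι : ∀ x → ι x ^ q ≈ ι x
  fixed-ι x = trans (sym (ιH.φ-^ x q)) (⟦⟧-cong (FiniteK.x^card≈x x))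

  -- Otherwise y and the q elements of ι(K) would be q + 1 distinct roots of Xᵠ - X.
  fixed⇒image : ∀ y → y ^ q ≈ y → Σ K.Carrier λ x → ι x ≈ y
  fixed⇒image y y^q≈y with FinP.any? (λ i → ι (HasCard.from HK i) ≟ y)
  ... | yes (i , ιxᵢ≈y) = HasCard.from HK i , ιxᵢ≈y
  ... | no  y∉ιK        = ⊥-elim (ℕP.<⇒≱ (ℕP.n<1+n q) (≡.subst (_≤ q) (≡.cong suc (ListP.length-tabulate image)) tooManyRoots))
    where
    image : Fin q → Carrier
    image i = ι (HasCard.from HK i)
    isRoot : ∀ {z} → z ^ q ≈ z → eval q Xᵠ-X z ≈ 0#
    isRoot z^q≈z = trans (eval-Xᵠ-X _) (x≈y⇒x∙y⁻¹≈ε z^q≈z)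
    tooManyRoots : length (y ∷ tabulate image) ≤ q
    tooManyRoots = Factorisation.roots≤degree (factorRoots q Xᵠ-X (y ∷ tabulate image) Xᵠ-X-monic
      (AllP.tabulate⁺ (λ i y≈ιxᵢ → y∉ιK (i , sym y≈ιxᵢ)) ∷ UniqueP.tabulate⁺ setoid (FiniteK.from-injective ∘ ι-injective))
      (isRoot y^q≈y ∷ AllP.tabulate⁺ (λ i → isRoot (fixed-ι _))))

  ι-monicCoeff : ∀ D (w′ : ℕ → K.Carrier) (w : ℕ → Carrier) → Monic D w → (∀ m → m < D → ι (w′ m) ≈ w m) →
    ∀ m → ι (monicCoeff K D w′ m) ≈ w m
  ι-monicCoeff D w′ w (lead , degree) below m with ℕP.<-cmp m D
  ... | tri< m<D _ _ = trans (⟦⟧-cong (K.reflexive (monicCoeff-< w′ m<D))) (below m m<D)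
  ... | tri≈ _ ≡.refl _ = trans (⟦⟧-cong (K.reflexive (monicCoeff-≡ D w′))) (trans 1#-homo (sym lead))
  ... | tri> _ _ D<m = trans (⟦⟧-cong (K.reflexive (monicCoeff-> w′ D<m))) (trans 0#-homo (sym (degree m D<m)))

  fixed-factorisation⇒reducible : ∀ {n d e} (a : ℕ → K.Carrier) (g h : ℕ → Carrier) → 1 ≤ d → 1 ≤ e → d ℕ.+ e ≡ n →
    Monic d g → Monic e h → (∀ m → g m ^ q ≈ g m) → (∀ m → h m ^ q ≈ h m) →
    (∀ m → mulCoeff L g h m ≈ ι (monicCoeff K n a m)) → ¬ IrreducibleMonic K n a
  fixed-factorisation⇒reducible {n} {d} {e} a g h 1≤d 1≤e d+e≡n g-monic h-monic g-fixed h-fixed gh≈a irreducible =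
    irreducible d e 1≤d 1≤e d+e≡n g′ h′ (λ m → ι-injective (begin
      ι (mulCoeff K (monicCoeff K d g′) (monicCoeff K e h′) m)        ≈⟨ ιH.φ-mulCoeff (monicCoeff K d g′) (monicCoeff K e h′) m ⟩
      mulCoeff L (ι ∘ monicCoeff K d g′) (ι ∘ monicCoeff K e h′) m
        ≈⟨ mulCoeff-cong (ι-monicCoeff d g′ g g-monic (λ m _ → proj₂ (fixed⇒image (g m) (g-fixed m))))
                         (ι-monicCoeff e h′ h h-monic (λ m _ → proj₂ (fixed⇒image (h m) (h-fixed m)))) m ⟩
      mulCoeff L g h m                                                 ≈⟨ gh≈a m ⟩
      ι (monicCoeff K n a m)                                           ∎))
    where
    g′ h′ : ℕ → K.Carrier
    g′ m = proj₁ (fixed⇒image (g m) (g-fixed m))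
    h′ m = proj₁ (fixed⇒image (h m) (h-fixed m))

module Frobenius {c ℓ} (L : CommutativeRing c ℓ) {p : ℕ} (pr : Prime p)
  (p·1≈0 : CommutativeRing._≈_ L (fromℕ L p) (CommutativeRing.0# L)) (r : ℕ) where
  open CommutativeRing L hiding (zero)
  open RingArithmetic L
  open FreshmansDream L

  q : ℕ
  q = p ℕ.^ r

  φ : ℕ → Carrier → Carrier
  φ t x = x ^ (q ℕ.^ t)

  φ-+ : ∀ t x y → φ t (x + y) ≈ φ t x + φ t y
  φ-+ t x y rewrite ℕP.^-*-assoc p r t = frobenius-+-iterate p pr p·1≈0 (r ℕ.* t) x y

  φ-fixed : ∀ {x} → x ^ q ≈ x → ∀ t → φ t x ≈ x
  φ-fixed {x} x^q≈x zero    = *-identityʳ x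
  φ-fixed {x} x^q≈x (suc t) = begin
    x ^ (q ℕ.* q ℕ.^ t)     ≈⟨ ^-assocʳ x q (q ℕ.^ t) ⟩
    (x ^ q) ^ (q ℕ.^ t)     ≈⟨ ^-congˡ (q ℕ.^ t) x^q≈x ⟩
    x ^ (q ℕ.^ t)           ≈⟨ φ-fixed x^q≈x t ⟩
    x                       ∎

  module φ-hom (t : ℕ) = HomomorphismProperties L L (φ t) (^-congˡ (q ℕ.^ t)) (φ-+ t)
    (λ x y → ^-distrib-* x y (q ℕ.^ t)) (1^n≈1 (q ℕ.^ t))

  φ-∘ : ∀ s t x → φ t (φ s x) ≈ φ (s ℕ.+ t) x
  φ-∘ s t x = trans (sym (^-assocʳ x (q ℕ.^ s) (q ℕ.^ t))) (reflexive (≡.cong (x ^_) (≡.sym (ℕP.^-distribˡ-+-* q s t))))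

module Conjugates {c ℓ c′ ℓ′} (p r n : ℕ) (pr : Prime p) (1≤r : 1 ≤ r)
  (K : CommutativeRing c ℓ) (FK : IsField K) (HK : HasCard K (p ℕ.^ r))
  (L : CommutativeRing c′ ℓ′) (FL : IsField L) (HL : HasCard L ((p ℕ.^ r) ℕ.^ n))
  (ι : CommutativeRing.Carrier K → CommutativeRing.Carrier L) (hom : IsRingHom K L ι)
  (fc : ℕ → CommutativeRing.Carrier K) (irreducible : IrreducibleMonic K n (fLower K n fc))
  (α : CommutativeRing.Carrier L)
  (root : CommutativeRing._≈_ L (sumR L (suc n) (λ m → CommutativeRing._*_ L (ι (monicCoeff K n (fLower K n fc) m)) (pow L α m)))
                                (CommutativeRing.0# L))
  where
  module K = CommutativeRing K
  open CommutativeRing L hiding (zero)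
  open RingArithmetic L
  open ElementarySymmetric L
  open Polynomials L FL
  open RingMorphisms.IsRingHomomorphism hom using (⟦⟧-cong; *-homo; 0#-homo; 1#-homo; -‿homo)
  open MonicCoeff K
  module FiniteL = FiniteField L FL HL
  open UniqueS setoid using (Unique)

  q : ℕ
  q = p ℕ.^ r

  2≤q : 2 ≤ q
  2≤q = ℕP.≤-trans (prime⇒2≤p pr) (≡.subst (_≤ q) (ℕP.*-identityʳ p) (ℕP.^-monoʳ-≤ p {{prime⇒nonZero pr}} 1≤r))

  open FixedField K FK HK 2≤q L FL HL ι hom using (fixed-ι; fixed-factorisation⇒reducible)

  p·1≈0 : fromℕ L p ≈ 0#
  p·1≈0 = FiniteL.x^n≈0⇒x≈0 (fromℕ L p) (r ℕ.* n) (begin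
    fromℕ L p ^ (r ℕ.* n)       ≈⟨ fromℕ-^ p (r ℕ.* n) ⟨
    fromℕ L (p ℕ.^ (r ℕ.* n))   ≈⟨ reflexive (≡.cong (fromℕ L) (≡.sym (ℕP.^-*-assoc p r n))) ⟩
    fromℕ L (q ℕ.^ n)           ≈⟨ FiniteL.fromℕ-card≈0 ⟩
    0#                          ∎)

  open Frobenius L pr p·1≈0 r using (φ; φ-∘; φ-fixed; module φ-hom)

  f : ℕ → Carrier
  f m = ι (monicCoeff K n (fLower K n fc) m)

  f-monic : Monic n f
  f-monic = trans (⟦⟧-cong (K.reflexive (monicCoeff-≡ n (fLower K n fc)))) 1#-homo
          , λ m n<m → trans (⟦⟧-cong (K.reflexive (monicCoeff-> (fLower K n fc) n<m))) 0#-homo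

  β : ℕ → Carrier
  β s = φ s α

  β-shift : ∀ s t → φ t (β s) ≈ β (s ℕ.+ t)
  β-shift s t = φ-∘ s t α

  β-periodic : ∀ s → β (n ℕ.+ s) ≈ β s
  β-periodic s = trans (sym (β-shift n s)) (^-congˡ (q ℕ.^ s) (FiniteL.x^card≈x α))

  β-root : ∀ t → eval n f (β t) ≈ 0#
  β-root t = begin
    eval n f (β t)                               ≈⟨ ∑-cong (suc n) (λ m _ → *-congʳ (sym (φ-fixed (fixed-ι _) t))) ⟩
    ∑ (suc n) (λ m → φ t (f m) * φ t α ^ m)      ≈⟨ φ-hom.φ-eval t n f α ⟨
    φ t (eval n f α)                             ≈⟨ ^-congˡ (q ℕ.^ t) root ⟩
    φ t 0#                                       ≈⟨ φ-hom.φ-0 t ⟩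
    0#                                           ∎

  φ-linTimes : ∀ t c w m → φ t (linTimes c w m) ≈ linTimes (φ t c) (φ t ∘ w) m
  φ-linTimes t c w zero    = ^-distrib-* c (w 0) (q ℕ.^ t)
  φ-linTimes t c w (suc m) = trans (Frobenius.φ-+ L pr p·1≈0 r t _ _) (+-congˡ (^-distrib-* c (w (suc m)) (q ℕ.^ t)))

  φ-linProduct : ∀ t cs w m → φ t (linProduct cs w m) ≈ linProduct (map (φ t) cs) (φ t ∘ w) m
  φ-linProduct t []       w m = refl
  φ-linProduct t (c ∷ cs) w m = trans (φ-linTimes t c (linProduct cs w) m) (linTimes-cong refl (φ-linProduct t cs w) m)

  NoPeriodBelow : ℕ → Set ℓ′
  NoPeriodBelow m = ∀ e → 1 ≤ e → e < m → ¬ β e ≈ β 0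

  noPeriodBelow-suc : ∀ {m} → NoPeriodBelow m → (1 ≤ m → ¬ β m ≈ β 0) → NoPeriodBelow (suc m)
  noPeriodBelow-suc below new e 1≤e e<1+m with ℕP.m≤n⇒m<n∨m≡n (ℕP.≤-pred e<1+m)
  ... | inj₁ e<m    = below e 1≤e e<m
  ... | inj₂ ≡.refl = new 1≤e

  leastPeriod : ∀ m → NoPeriodBelow m ⊎ Σ ℕ (λ d → 1 ≤ d × d < m × β d ≈ β 0 × NoPeriodBelow d)
  leastPeriod zero = inj₁ (λ _ _ ())
  leastPeriod (suc m) with leastPeriod m
  ... | inj₂ (d , 1≤d , d<m , βd≈β0 , below) = inj₂ (d , 1≤d , ℕP.m<n⇒m<1+n d<m , βd≈β0 , below)
  ... | inj₁ below with 1 ℕ.≤? m | β m FiniteL.≟ β 0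
  ...   | yes 1≤m | yes βm≈β0 = inj₂ (m , 1≤m , ℕP.≤-refl , βm≈β0 , below)
  ...   | yes _   | no  βm≉β0 = inj₁ (noPeriodBelow-suc below (λ _ → βm≉β0))
  ...   | no  1≰m | _         = inj₁ (noPeriodBelow-suc below (λ 1≤m → ⊥-elim (1≰m 1≤m)))

  β-collision : ∀ {i j} → i < j → j ≤ n → β i ≈ β j → β 0 ≈ β (j ∸ i)
  β-collision {i} {j} i<j j≤n βi≈βj = begin
    β 0                      ≈⟨ β-periodic 0 ⟨
    β (n ℕ.+ 0)              ≈⟨ reflexive (≡.cong β (≡.trans (ℕP.+-identityʳ n) (≡.sym (ℕP.m+[n∸m]≡n i≤n)))) ⟩
    β (i ℕ.+ (n ∸ i))        ≈⟨ β-shift i (n ∸ i) ⟨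
    φ (n ∸ i) (β i)          ≈⟨ ^-congˡ (q ℕ.^ (n ∸ i)) βi≈βj ⟩
    φ (n ∸ i) (β j)          ≈⟨ β-shift j (n ∸ i) ⟩
    β (j ℕ.+ (n ∸ i))        ≈⟨ reflexive (≡.cong β j+[n-i]≡n+[j-i]) ⟩
    β (n ℕ.+ (j ∸ i))        ≈⟨ β-periodic (j ∸ i) ⟩
    β (j ∸ i)                ∎
    where
    i≤n = ℕP.≤-trans (ℕP.<⇒≤ i<j) j≤n
    j+[n-i]≡n+[j-i] : j ℕ.+ (n ∸ i) ≡ n ℕ.+ (j ∸ i)
    j+[n-i]≡n+[j-i] = ≡.trans (≡.cong (ℕ._+ (n ∸ i)) (≡.sym (ℕP.m∸n+n≡m (ℕP.<⇒≤ i<j))))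
                     (≡.trans (ℕP.+-assoc (j ∸ i) i (n ∸ i))
                     (≡.trans (≡.cong ((j ∸ i) ℕ.+_) (ℕP.m+[n∸m]≡n i≤n)) (ℕP.+-comm (j ∸ i) n)))

  conjugates-unique : ∀ m → m ≤ n → NoPeriodBelow m → Unique (applyUpTo β m)
  conjugates-unique m m≤n below = UniqueP.applyUpTo⁺₁ setoid β m (λ {i} {j} i<j j<m βi≈βj →
    below (j ∸ i) (ℕP.m<n⇒0<n∸m i<j) (ℕP.≤-<-trans (ℕP.m∸n≤m j i) j<m)
          (sym (β-collision i<j (ℕP.≤-trans (ℕP.<⇒≤ j<m) m≤n) βi≈βj)))

  conjugates-roots : ∀ m → All (λ y → eval n f y ≈ 0#) (applyUpTo β m)
  conjugates-roots m = AllP.applyUpTo⁺₂ β m β-root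

  rootFactors : ℕ → List Carrier
  rootFactors d = map -_ (applyUpTo β d)

  -- If β d ≈ β 0, then φ 1 maps β₀ … β_{d-1} to β₁ … β_d, a rotation of the same roots.
  φ-rootFactors : ∀ d → β d ≈ β 0 → ∀ w m → linProduct (map (φ 1) (rootFactors d)) w m ≈ linProduct (rootFactors d) w m
  φ-rootFactors zero     _      w m = refl
  φ-rootFactors (suc d′) βd≈β0 w m = begin
    linProduct (map (φ 1) (rootFactors d)) w m   ≈⟨ linProduct-cong φcs≋rotated (λ _ → refl) m ⟩
    linProduct (later ++ (- β 0) ∷ []) w m      ≈⟨ linProduct-∷ʳ later (- β 0) w m ⟩
    linProduct (- β 0 ∷ later) w m              ≈⟨ linProduct-cong (≋-reflexive (≡.sym (ListP.map-applyUpTo β -_ d))) (λ _ → refl) m ⟩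
    linProduct (rootFactors d) w m               ∎
    where
    d = suc d′
    later = applyUpTo (λ s → - β (suc s)) d′
    shifted : ∀ s → φ 1 (- β s) ≈ - β (suc s)
    shifted s = trans (φ-hom.φ-neg 1 (β s)) (-‿cong (trans (β-shift s 1) (reflexive (≡.cong β (ℕP.+-comm s 1)))))
    φcs≋rotated : map (φ 1) (rootFactors d) ≋ later ++ (- β 0) ∷ []
    φcs≋rotated = ≋-trans (≋-reflexive (≡.trans (≡.cong (map (φ 1)) (ListP.map-applyUpTo β -_ d))
                                                 (ListP.map-applyUpTo (-_ ∘ β) (φ 1) d)))
                 (≋-trans (applyUpTo-cong d (λ s _ → shifted s))
                 (≋-trans (≋-reflexive (≡.sym (ListP.applyUpTo-∷ʳ (λ s → - β (suc s)) d′)))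
                          (++⁺ ≋-refl (-‿cong βd≈β0 ∷ []))))

  periodFactor-fixed : ∀ d → β d ≈ β 0 → ∀ m → φ 1 (linProduct (rootFactors d) one m) ≈ linProduct (rootFactors d) one m
  periodFactor-fixed d βd≈β0 m = begin
    φ 1 (linProduct cs one m)                ≈⟨ φ-linProduct 1 cs one m ⟩
    linProduct (map (φ 1) cs) (φ 1 ∘ one) m  ≈⟨ linProduct-cong (≋-refl {map (φ 1) cs}) φ-one m ⟩
    linProduct (map (φ 1) cs) one m          ≈⟨ φ-rootFactors d βd≈β0 one m ⟩
    linProduct cs one m                      ∎
    where
    cs = rootFactors d
    φ-one : ∀ m → φ 1 (one m) ≈ one m
    φ-one zero    = 1^n≈1 (q ℕ.^ 1)
    φ-one (suc m) = φ-hom.φ-0 1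

  cofactor-fixed : ∀ d u → β d ≈ β 0 → DegreeAtMost (n ∸ d) u → (∀ m → f m ≈ linProduct (rootFactors d) u m) →
    ∀ m → u m ≈ φ 1 (u m)
  cofactor-fixed d u βd≈β0 deg f≈cs·u = linProduct-cancel cs deg (λ m lt → trans (^-congˡ (q ℕ.^ 1) (deg m lt)) (φ-hom.φ-0 1))
    (λ m → begin
      linProduct cs u m                     ≈⟨ f≈cs·u m ⟨
      f m                                   ≈⟨ φ-fixed (fixed-ι _) 1 ⟨
      φ 1 (f m)                             ≈⟨ ^-congˡ (q ℕ.^ 1) (f≈cs·u m) ⟩
      φ 1 (linProduct cs u m)               ≈⟨ φ-linProduct 1 cs u m ⟩
      linProduct (map (φ 1) cs) (φ 1 ∘ u) m ≈⟨ φ-rootFactors d βd≈β0 (φ 1 ∘ u) m ⟩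
      linProduct cs (φ 1 ∘ u) m             ∎)
    where cs = rootFactors d

  -- A least period d < n splits f = ∏_{i<d} (X - βᵢ) · u with both factors fixed by φ 1.
  period⇒reducible : ∀ d → 1 ≤ d → d < n → β d ≈ β 0 → NoPeriodBelow d → ¬ IrreducibleMonic K n (fLower K n fc)
  period⇒reducible d 1≤d d<n βd≈β0 below =
    fixed-factorisation⇒reducible (fLower K n fc) (linProduct cs one) quotient 1≤d (ℕP.m<n⇒0<n∸m d<n) (ℕP.m+[n∸m]≡n (ℕP.<⇒≤ d<n))
      (≡.subst (λ D → Monic D (linProduct cs one)) length-cs (monic-linProduct cs monic-one))
      (≡.subst (λ D → Monic (n ∸ D) quotient) (ListP.length-applyUpTo β d) quotient-monic)
      (λ m → trans (sym (φ₁ _)) (periodFactor-fixed d βd≈β0 m))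
      (λ m → trans (sym (φ₁ _)) (sym (cofactor-fixed d quotient βd≈β0 degree factorisation m)))
      (λ m → trans (mulCoeff-linProductˡ cs quotient m) (sym (factorisation m)))
    where
    cs = rootFactors d
    open Factorisation (factorRoots n f (applyUpTo β d) f-monic (conjugates-unique d (ℕP.<⇒≤ d<n) below) (conjugates-roots d))
    φ₁ : ∀ x → φ 1 x ≈ x ^ q
    φ₁ x = reflexive (≡.cong (x ^_) (ℕP.*-identityʳ q))
    length-cs : length cs ℕ.+ 0 ≡ d
    length-cs = ≡.trans (ℕP.+-identityʳ _) (≡.trans (ListP.length-map -_ (applyUpTo β d)) (ListP.length-applyUpTo β d))
    degree : DegreeAtMost (n ∸ d) quotient
    degree = ≡.subst (λ D → DegreeAtMost (n ∸ D) quotient) (ListP.length-applyUpTo β d) (proj₂ quotient-monic)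

  conjugates : List Carrier
  conjugates = applyUpTo β n

  length-conjugates : length conjugates ≡ n
  length-conjugates = ListP.length-applyUpTo β n

  conjugates-distinct : Unique conjugates
  conjugates-distinct with leastPeriod n
  ... | inj₁ below                           = conjugates-unique n ℕP.≤-refl below
  ... | inj₂ (d , 1≤d , d<n , βd≈β0 , below) = ⊥-elim (period⇒reducible d 1≤d d<n βd≈β0 below irreducible)

  f≈esym : ∀ k → k ≤ n → f (n ∸ k) ≈ (- 1#) ^ k * esym k conjugates
  f≈esym k k≤n = begin
    f (n ∸ k)                            ≈⟨ factorisation (n ∸ k) ⟩
    linProduct cs quotient (n ∸ k)       ≈⟨ linProduct-cong (≋-refl {cs}) quotient≈one (n ∸ k) ⟩
    linProduct cs one (n ∸ k)            ≈⟨ reflexive (≡.cong (λ N → linProduct cs one (N ∸ k)) (≡.sym length-cs)) ⟩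
    linProduct cs one (length cs ∸ k)    ≈⟨ vieta cs k (≡.subst (k ≤_) (≡.sym length-cs) k≤n) ⟩
    esym k cs                            ≈⟨ esym-map-neg conjugates k ⟩
    (- 1#) ^ k * esym k conjugates       ∎
    where
    cs = map -_ conjugates
    length-cs : length cs ≡ n
    length-cs = ≡.trans (ListP.length-map -_ conjugates) length-conjugates
    open Factorisation (factorRoots n f conjugates f-monic conjugates-distinct (conjugates-roots n))
    constant : n ∸ length conjugates ≡ 0
    constant = ≡.trans (≡.cong (n ∸_) length-conjugates) (ℕP.n∸n≡0 n)
    quotient≈one : ∀ m → quotient m ≈ one m
    quotient≈one zero    = ≡.subst (λ D → quotient D ≈ 1#) constant (proj₁ quotient-monic)
    quotient≈one (suc m) = proj₂ quotient-monic (suc m) (≡.subst (_< suc m) (≡.sym constant) (s≤s z≤n))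

  module ιH = HomomorphismProperties K L ι ⟦⟧-cong (RingMorphisms.IsRingHomomorphism.+-homo hom) *-homo 1#-homo

  ι-fc≈esym : ∀ k → 1 ≤ k → k ≤ n → ι (fc k) ≈ esym k conjugates
  ι-fc≈esym k 1≤k k≤n = begin
    ι (fc k)                           ≈⟨ *-identityˡ _ ⟨
    1# * ι (fc k)                      ≈⟨ *-congʳ ([-1]^n*[-1]^n≈1 k) ⟨
    sign * sign * ι (fc k)             ≈⟨ *-assoc _ _ _ ⟩
    sign * (sign * ι (fc k))           ≈⟨ *-congˡ (trans (sym f[n-k]≈sign*ι[fc]) (f≈esym k k≤n)) ⟩
    sign * (sign * esym k conjugates)  ≈⟨ *-assoc _ _ _ ⟨
    sign * sign * esym k conjugates    ≈⟨ *-congʳ ([-1]^n*[-1]^n≈1 k) ⟩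
    1# * esym k conjugates             ≈⟨ *-identityˡ _ ⟩
    esym k conjugates                  ∎
    where
    sign = (- 1#) ^ k
    n∸k<n : n ∸ k < n
    n∸k<n = ℕP.∸-monoʳ-< {n} {k} {0} 1≤k k≤n
    f[n-k]≈sign*ι[fc] : f (n ∸ k) ≈ sign * ι (fc k)
    f[n-k]≈sign*ι[fc] = begin
      f (n ∸ k)                                                  ≈⟨ ⟦⟧-cong (K.reflexive (monicCoeff-< (fLower K n fc) n∸k<n)) ⟩
      ι (pow K (K.- K.1#) (n ∸ (n ∸ k)) K.* fc (n ∸ (n ∸ k)))    ≈⟨ *-homo _ _ ⟩
      ι (pow K (K.- K.1#) (n ∸ (n ∸ k))) * ι (fc (n ∸ (n ∸ k)))
        ≈⟨ *-congʳ (trans (ιH.φ-^ (K.- K.1#) (n ∸ (n ∸ k))) (^-congˡ (n ∸ (n ∸ k)) (trans (-‿homo K.1#) (-‿cong 1#-homo)))) ⟩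
      (- 1#) ^ (n ∸ (n ∸ k)) * ι (fc (n ∸ (n ∸ k)))              ≈⟨ reflexive (≡.cong (λ i → (- 1#) ^ i * ι (fc i)) (ℕP.m∸[m∸n]≡n k≤n)) ⟩
      sign * ι (fc k)                                            ∎

  conjugates-rotated : ∀ j i → i < n → esym j (applyUpTo (λ s → β (suc s ℕ.+ i)) (n ∸ 1)) ≈ esym j (deleteNth conjugates i)
  conjugates-rotated j i i<n = begin
    esym j (applyUpTo shift (n ∸ 1))                                           ≈⟨ reflexive (≡.cong (λ N → esym j (applyUpTo shift N)) n∸1≡a+i) ⟩
    esym j (applyUpTo shift (a ℕ.+ i))                                         ≈⟨ reflexive (≡.cong (esym j) (applyUpTo-+ shift a i)) ⟩
    esym j (applyUpTo shift a ++ applyUpTo (λ s → shift (a ℕ.+ s)) i)          ≈⟨ esym-cong (++⁺ after wrapped) j ⟩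
    esym j (applyUpTo (λ s → β (suc i ℕ.+ s)) a ++ applyUpTo β i)              ≈⟨ esym-++-comm (applyUpTo (λ s → β (suc i ℕ.+ s)) a) (applyUpTo β i) j ⟩
    esym j (applyUpTo β i ++ applyUpTo (λ s → β (suc i ℕ.+ s)) a)              ≈⟨ reflexive (≡.cong (esym j) (≡.sym (deleteNth-applyUpTo β i<n))) ⟩
    esym j (deleteNth conjugates i)                                            ∎
    where
    shift = λ s → β (suc s ℕ.+ i)
    a = n ∸ suc i
    1+i+a≡n : suc i ℕ.+ a ≡ n
    1+i+a≡n = ℕP.m+[n∸m]≡n i<n
    n∸1≡a+i : n ∸ 1 ≡ a ℕ.+ i
    n∸1≡a+i = ≡.trans (≡.cong (_∸ 1) (≡.sym 1+i+a≡n)) (ℕP.+-comm i a)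
    after : applyUpTo shift a ≋ applyUpTo (λ s → β (suc i ℕ.+ s)) a
    after = applyUpTo-cong a (λ s _ → reflexive (≡.cong (β ∘ suc) (ℕP.+-comm s i)))
    wrapped : applyUpTo (λ s → shift (a ℕ.+ s)) i ≋ applyUpTo β i
    wrapped = applyUpTo-cong i (λ s _ → trans (reflexive (≡.cong β (index s))) (β-periodic s))
      where
      index : ∀ s → suc (a ℕ.+ s) ℕ.+ i ≡ n ℕ.+ s
      index s = ≡.trans (≡.cong suc (≡.trans (ℕP.+-assoc a s i) (≡.trans (≡.cong (a ℕ.+_) (ℕP.+-comm s i))
                  (≡.trans (≡.sym (ℕP.+-assoc a i s)) (≡.cong (ℕ._+ s) (ℕP.+-comm a i))))))
                  (≡.cong (ℕ._+ s) 1+i+a≡n)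

  φ-W : ∀ j i → i < n → φ i (W L q (suc j) n α) ≈ esym j (deleteNth conjugates i)
  φ-W j i i<n = begin
    φ i (W L q (suc j) n α)                               ≈⟨ ^-congˡ (q ℕ.^ i) (sum-choose≈esym q α j exponents) ⟩
    φ i (esym j (map β exponents))                        ≈⟨ φ-hom.φ-esym i j (map β exponents) ⟩
    esym j (map (φ i) (map β exponents))                  ≈⟨ esym-cong (≋-trans (≋-reflexive map-map) (applyUpTo-cong (n ∸ 1) (λ s _ → β-shift (suc s) i))) j ⟩
    esym j (applyUpTo (λ s → β (suc s ℕ.+ i)) (n ∸ 1))    ≈⟨ conjugates-rotated j i i<n ⟩
    esym j (deleteNth conjugates i)                       ∎
    where
    exponents = map suc (upTo (n ∸ 1))
    map-map : map (φ i) (map β exponents) ≡ applyUpTo (φ i ∘ β ∘ suc) (n ∸ 1)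
    map-map = ≡.trans (≡.cong (λ ss → map (φ i) (map β ss)) (ListP.map-upTo suc (n ∸ 1)))
              (≡.trans (≡.cong (map (φ i)) (ListP.map-applyUpTo suc β (n ∸ 1))) (ListP.map-applyUpTo (β ∘ suc) (φ i) (n ∸ 1)))

  trace-αW : ∀ j → Tr L q n (α * W L q (suc j) n α) ≈ fromℕ L (suc j) * esym (suc j) conjugates
  trace-αW j = begin
    ∑ n (λ i → φ i (α * W L q (suc j) n α))
      ≈⟨ ∑-cong n (λ i i<n → trans (^-distrib-* α _ (q ℕ.^ i)) (*-congˡ (φ-W j i i<n))) ⟩
    ∑ n (λ i → β i * esym j (deleteNth conjugates i))
      ≈⟨ ∑-cong n (λ i i<n → *-congʳ (reflexive (≡.sym (nth-applyUpTo β i<n)))) ⟩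
    ∑ n (λ i → nth conjugates i * esym j (deleteNth conjugates i))
      ≈⟨ reflexive (≡.cong (λ N → ∑ N (λ i → nth conjugates i * esym j (deleteNth conjugates i))) (≡.sym length-conjugates)) ⟩
    ∑ (length conjugates) (λ i → nth conjugates i * esym j (deleteNth conjugates i))
      ≈⟨ ∑-nth*esym-deleteNth conjugates j ⟩
    fromℕ L (suc j) * esym (suc j) conjugates
      ∎


  coefficient≈trace : ∀ k → 1 ≤ k → k < n → ∀ kinv → kinv K.* fromℕ K k K.≈ K.1# →
    ι (fc k) ≈ ι kinv * Tr L q n (α * W L q k n α)
  coefficient≈trace k@(suc j) 1≤k k<n kinv kinv·k≈1 = begin
    ι (fc k)                                     ≈⟨ ι-fc≈esym k 1≤k (ℕP.<⇒≤ k<n) ⟩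
    esym k conjugates                            ≈⟨ *-identityˡ _ ⟨
    1# * esym k conjugates                       ≈⟨ *-congʳ (trans (⟦⟧-cong kinv·k≈1) 1#-homo) ⟨
    ι (kinv K.* fromℕ K k) * esym k conjugates   ≈⟨ *-congʳ (trans (*-homo kinv (fromℕ K k)) (*-congˡ (ιH.φ-fromℕ k))) ⟩
    ι kinv * fromℕ L k * esym k conjugates       ≈⟨ *-assoc _ _ _ ⟩
    ι kinv * (fromℕ L k * esym k conjugates)     ≈⟨ *-congˡ (trace-αW j) ⟨
    ι kinv * Tr L q n (α * W L q k n α)          ∎

open import Data.Nat using (_^_)
open CommutativeRing using (Carrier; _≈_; _*_; 0#; 1#)

-- p ∤ k only guarantees the inverse kinv, which is supplied; 2 ≤ n follows from 1 ≤ k < n.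
lemma2p1 : ∀ {c ℓ c′ ℓ′} (p r n : ℕ) → Prime p → 1 ≤ r → 2 ≤ n →
  (K : CommutativeRing c ℓ) → IsField K → HasCard K (p ^ r) →
  (L : CommutativeRing c′ ℓ′) → IsField L → HasCard L ((p ^ r) ^ n) →
  (ι : Carrier K → Carrier L) → IsRingHom K L ι →
  (fc : ℕ → Carrier K) → IrreducibleMonic K n (fLower K n fc) →
  (α : Carrier L) →
  _≈_ L (sumR L (suc n) (λ m → _*_ L (ι (monicCoeff K n (fLower K n fc) m)) (pow L α m))) (0# L) →
  (k : ℕ) → 1 ≤ k → k < n → ¬ (p ∣ k) →
  (kinv : Carrier K) → _≈_ K (_*_ K kinv (fromℕ K k)) (1# K) →
  _≈_ L (ι (fc k)) (_*_ L (ι kinv) (Tr L (p ^ r) n (_*_ L α (W L (p ^ r) k n α))))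
lemma2p1 p r n pr 1≤r _ K FK HK L FL HL ι hom fc irreducible α root k 1≤k k<n _ =
  Conjugates.coefficient≈trace p r n pr 1≤r K FK HK L FL HL ι hom fc irreducible α root k 1≤k k<n
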